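{- Let $q$ be a prime power, $n,m\ge 2$, and let $C\le\mathbb{F}_{q^m}^n$ be an $\mathbb{F}_{q^m}$-linear code of dimension $k\ge 1$ and minimum rank distance $d$. Then: (1) $\ell_j^{(1)}(C)=m_j(C)$ for all $j\in\{1,\dots,k\}$; (2) $\ell_1^{(i)}(C)=\lceil d/i\rceil$ for all $i\in\{1,\dots,n\}$; (3) $\ell_j^{(i)}(C)\le n$ for all $i\in\{1,\dots,n\}$, $j\in\{1,\dots,k\}$; (4) $\ell_j^{(i)}(C)<\ell_{j+1}^{(i)}(C)$ for all $i\in\{1,\dots,n\}$, $j\in\{1,\dots,k-1\}$; (5) $\ell_j^{(i+1)}(C)\le\ell_j^{(i)}(C)$ for all $i\in\{1,\dots,n-1\}$, $j\in\{1,\dots,k\}$; (6) $\ell_j^{(i)}(C)\le n-k+j$ for all $i\in\{1,\dots,n\}$, $j\in\{1,\dots,k\}$; (7) $\ell_j^{(i)}(C)\ge\lceil d/i\rceil+j-1$ for all $i\in\{1,\dots,n\}$, $j\in\{1,\dots,k\}$.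
   Context: The rank $\mathrm{rk}(v)$ of $v\in\mathbb{F}_{q^m}^n$ is the $\mathbb{F}_q$-dimension of the $\mathbb{F}_q$-span of its entries; the minimum distance of a nonzero code $C$ is $d=\min\{\mathrm{rk}(v):v\in C,\ v\ne 0\}$. All dimensions are over $\mathbb{F}_{q^m}$. For $i\in\{1,\dots,n\}$, $\mathscr{L}_i(n,m;q)$ is the set of $\mathbb{F}_{q^m}$-subspaces of $\mathbb{F}_{q^m}^n$ spanned by vectors of rank at most $i$ (including $\{0\}$). The $(i,j)$-th lattice-rank weight of $C$ is $\ell_j^{(i)}(C)=\min\{\dim X: X\in\mathscr{L}_i(n,m;q),\ \dim(C\cap X)\ge j\}$. The $j$-th generalized rank weight is $m_j(C)=\min\{\dim A: A\in\mathcal{A},\ \dim(A\cap C)\ge j\}$, where $\mathcal{A}$ is the set of $\mathbb{F}_{q^m}$-subspaces of $\mathbb{F}_{q^m}^n$ having a basis of vectors with all entries in $\mathbb{F}_q$. -}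

module Defs where

open import Level using (Level; _⊔_) renaming (suc to lsuc)
open import Algebra.Bundles using (CommutativeRing)
open import Data.Nat as ℕ using (ℕ; zero; suc; _^_; _≤_)
open import Data.Nat.Primality using (Prime)
open import Data.Fin using (Fin; zero; suc)
open import Data.Product using (Σ; ∃; _×_; _,_)
open import Data.Unit.Polymorphic using (⊤)
open import Relation.Nullary using (¬_)
open import Relation.Unary using (Pred)
open import Relation.Binary.PropositionalEquality using (_≡_)

record Field (c ℓ : Level) : Set (lsuc (c ⊔ ℓ)) where
  field
    commutativeRing : CommutativeRing c ℓ
  open CommutativeRing commutativeRing public
  field
    1≉0     : ¬ (1# ≈ 0#)
    inverse : ∀ x → ¬ (x ≈ 0#) → ∃ λ y → x * y ≈ 1#

IsPrimePower : ℕ → Set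
IsPrimePower q = Σ ℕ λ p → Σ ℕ λ e → Prime p × 1 ≤ e × q ≡ p ^ e

-- ⌈ d / i ⌉ for i ≥ 1 (the value at i = 0 is junk and never used)
ceilDiv : ℕ → ℕ → ℕ
ceilDiv d zero    = zero
ceilDiv d (suc i) = (d ℕ.+ i) ℕ./ suc i

module _ {c ℓ : Level} (F : Field c ℓ) where
  open Field F using (Carrier; _≈_; _+_; _*_; -_; 0#; 1#)

  sumF : (r : ℕ) → (Fin r → Carrier) → Carrier
  sumF zero    f = 0#
  sumF (suc r) f = f zero + sumF r (λ t → f (suc t))

  HasCard : Pred Carrier (c ⊔ ℓ) → ℕ → Set (c ⊔ ℓ)
  HasCard P N = Σ (Fin N → Carrier) λ f →
      (∀ t → P (f t))
    × (∀ t t' → f t ≈ f t' → t ≡ t')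
    × (∀ x → P x → ∃ λ t → x ≈ f t)

  record IsSubfield (K : Pred Carrier (c ⊔ ℓ)) : Set (c ⊔ ℓ) where
    field
      resp   : ∀ {x y} → x ≈ y → K x → K y
      zero∈  : K 0#
      one∈   : K 1#
      +-cl   : ∀ {x y} → K x → K y → K (x + y)
      *-cl   : ∀ {x y} → K x → K y → K (x * y)
      neg-cl : ∀ {x} → K x → K (- x)
      inv-cl : ∀ {x y} → K x → x * y ≈ 1# → K y

  Vec : ℕ → Set c
  Vec n = Fin n → Carrier

  _≈v_ : ∀ {n} → Vec n → Vec n → Set ℓ
  u ≈v v = ∀ s → u s ≈ v s

  IsZeroVec : ∀ {n} → Vec n → Set ℓ
  IsZeroVec v = ∀ s → v s ≈ 0#

  InSpan : ∀ {n r} → (Fin r → Vec n) → Vec n → Set (c ⊔ ℓ)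
  InSpan {n} {r} g x = Σ (Fin r → Carrier) λ a →
    ∀ s → x s ≈ sumF r (λ t → a t * g t s)

  LinIndep : ∀ {n r} → (Fin r → Vec n) → Set (c ⊔ ℓ)
  LinIndep {n} {r} g = ∀ (a : Fin r → Carrier) →
    (∀ s → sumF r (λ t → a t * g t s) ≈ 0#) → ∀ t → a t ≈ 0#

  record IsSubspace {n : ℕ} (X : Pred (Vec n) (c ⊔ ℓ)) : Set (c ⊔ ℓ) where
    field
      resp   : ∀ {u v} → u ≈v v → X u → X v
      zero∈  : X (λ _ → 0#)
      +-cl   : ∀ {u v} → X u → X v → X (λ s → u s + v s)
      *-cl   : ∀ a {u} → X u → X (λ s → a * u s)

  IsBasis : ∀ {n w} → Pred (Vec n) (c ⊔ ℓ) → (Fin w → Vec n) → Set (c ⊔ ℓ)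
  IsBasis X b = (∀ t → X (b t)) × LinIndep b × (∀ x → X x → InSpan b x)

  HasDim : ∀ {n} → Pred (Vec n) (c ⊔ ℓ) → ℕ → Set (c ⊔ ℓ)
  HasDim {n} X w = Σ (Fin w → Vec n) λ b → IsBasis X b

  DimAtLeast : ∀ {n} → Pred (Vec n) (c ⊔ ℓ) → ℕ → Set (c ⊔ ℓ)
  DimAtLeast {n} X j = Σ (Fin j → Vec n) λ b → (∀ t → X (b t)) × LinIndep b

  _∩_ : ∀ {n} → Pred (Vec n) (c ⊔ ℓ) → Pred (Vec n) (c ⊔ ℓ) → Pred (Vec n) (c ⊔ ℓ)
  (X ∩ Y) x = X x × Y x

  module _ (K : Pred Carrier (c ⊔ ℓ)) where

    InKSpan : ∀ {r} → (Fin r → Carrier) → Carrier → Set (c ⊔ ℓ)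
    InKSpan {r} b x = Σ (Fin r → Carrier) λ a →
      (∀ t → K (a t)) × x ≈ sumF r (λ t → a t * b t)

    KIndep : ∀ {r} → (Fin r → Carrier) → Set (c ⊔ ℓ)
    KIndep {r} b = ∀ (a : Fin r → Carrier) → (∀ t → K (a t)) →
      sumF r (λ t → a t * b t) ≈ 0# → ∀ t → a t ≈ 0#

    HasRank : ∀ {n} → Vec n → ℕ → Set (c ⊔ ℓ)
    HasRank {n} v r = Σ (Fin r → Carrier) λ b →
        KIndep b
      × (∀ t → InKSpan v (b t))
      × (∀ s → InKSpan b (v s))

    IsMinRankDist : ∀ {n} → Pred (Vec n) (c ⊔ ℓ) → ℕ → Set (c ⊔ ℓ)
    IsMinRankDist {n} C d =
        (Σ (Vec n) λ v → C v × ¬ IsZeroVec v × HasRank v d)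
      × (∀ v r → C v → ¬ IsZeroVec v → HasRank v r → d ≤ r)

    InLattice : ∀ {n} → ℕ → Pred (Vec n) (c ⊔ ℓ) → Set (c ⊔ ℓ)
    InLattice {n} i X = Σ ℕ λ N → Σ (Fin N → Vec n) λ g →
        (∀ t → Σ ℕ λ r → r ≤ i × HasRank (g t) r)
      × (∀ x → (X x → InSpan g x) × (InSpan g x → X x))

    InRational : ∀ {n} → Pred (Vec n) (c ⊔ ℓ) → Set (c ⊔ ℓ)
    InRational {n} A = IsSubspace A × Σ ℕ λ w → Σ (Fin w → Vec n) λ b →
      (∀ t s → K (b t s)) × IsBasis A b

    -- w = ℓ_j^{(i)}(C)
    IsLatticeRankWeight : ∀ {n} → ℕ → ℕ → Pred (Vec n) (c ⊔ ℓ) → ℕ → Set (lsuc (c ⊔ ℓ))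
    IsLatticeRankWeight {n} i j C w =
        (Σ (Pred (Vec n) (c ⊔ ℓ)) λ X →
           InLattice i X × HasDim X w × DimAtLeast (C ∩ X) j)
      × (∀ (X : Pred (Vec n) (c ⊔ ℓ)) w' →
           InLattice i X → HasDim X w' → DimAtLeast (C ∩ X) j → w ≤ w')

    -- w = m_j(C)
    IsGenRankWeight : ∀ {n} → ℕ → Pred (Vec n) (c ⊔ ℓ) → ℕ → Set (lsuc (c ⊔ ℓ))
    IsGenRankWeight {n} j C w =
        (Σ (Pred (Vec n) (c ⊔ ℓ)) λ A →
           InRational A × HasDim A w × DimAtLeast (A ∩ C) j)
      × (∀ (A : Pred (Vec n) (c ⊔ ℓ)) w' →
           InRational A → HasDim A w' → DimAtLeast (A ∩ C) j → w ≤ w')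

module Submission where

-- Over a finite field every notion involved is decidable, so the minimum defining ℓ_j^(i)(C)
-- exists and is found by bounded search below the whole space F^n.  A vector of rank r can be
-- written Σ_t b_t u_t with K-independent scalars b_t and K-rational vectors u_t admitting a
-- K-rational dual family; grouping the r terms into ⌈r/i⌉ blocks of at most i terms yields
-- ⌈r/i⌉ independent vectors of rank ≤ i whose span contains the vector.  Conversely rank is
-- subadditive, so a space spanned by w vectors of rank ≤ i only contains vectors of rank
-- ≤ w·i; together this is (2).  A vector of rank one is a scalar multiple of a K-rational
-- vector, which gives (1).  Eliminating one generator of an optimal space for j+1 leaves a
-- lattice space still meeting C in dimension j, which gives (4); (3) and (5) are monotonicity
-- of the minimum, and (6), (7) follow from (2), (3), (4) by induction on j.

open import Level using (Level; _⊔_)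
open import Defs
open import Data.Nat as ℕ using (ℕ; zero; suc; _∸_; _^_; _≤_; _<_; z≤n; s≤s)
import Data.Nat.Properties as ℕₚ
open import Data.Nat.DivMod using (_%_; m≡m%n+[m/n]*n; m%n<n; m<n*o⇒m/o<n)
open import Data.Fin using (Fin; zero; suc; punchIn; _↑ˡ_; _↑ʳ_)
import Data.Fin as Fin
open import Data.Fin.Properties using (any?; all?; ¬∀⟶∃¬)
import Data.Fin.Properties as Finₚ
open import Data.Vec.Functional using ([]; _∷_; _++_; insertAt)
open import Data.Vec.Functional.Properties using (insertAt-lookup; insertAt-punchIn; lookup-++ˡ; lookup-++ʳ)
open import Data.Vec.Functional.Relation.Unary.All.Properties using (++⁺)
open import Data.Sum using (inj₁; inj₂)
open import Data.Product using (Σ; ∃; _×_; _,_; proj₁; proj₂)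
open import Data.Unit.Polymorphic using (⊤; tt)
open import Function using (_∘_; id)
open import Relation.Binary.Definitions using (Decidable)
open import Relation.Binary.PropositionalEquality as ≡ using (_≡_)
open import Relation.Nullary using (¬_; Dec; yes; no; ¬?)
open import Relation.Nullary.Decidable using (_×-dec_; _→-dec_)
open import Relation.Nullary.Negation using (contradiction)
open import Relation.Unary using (Pred)
import Relation.Unary as U

module LeastWitness {a} {Q : ℕ → Set a} (Q? : U.Decidable Q) where

  ∃≤? : ∀ N → Dec (∃ λ w → w ≤ N × Q w)
  ∃≤? N with ℕₚ.anyUpTo? Q? (suc N)
  ... | yes (w , w<1+N , q) = yes (w , ℕ.s≤s⁻¹ w<1+N , q)
  ... | no none             = no λ (w , w≤N , q) → none (w , s≤s w≤N , q)

  least : ∀ N → (∃ λ w → w ≤ N × Q w) → ∃ λ w → Q w × (∀ w' → Q w' → w ≤ w')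
  least zero    (.0 , z≤n , q)    = 0 , q , λ _ _ → z≤n
  least (suc N) (w , w≤1+N , q) with ∃≤? N
  ... | yes below = least N below
  ... | no none   = w , q , minimal
    where
    minimal : ∀ w' → Q w' → w ≤ w'
    minimal w' q' with w' ℕₚ.≤? N
    ... | yes w'≤N = contradiction (w' , w'≤N , q') none
    ... | no  w'≰N = ℕₚ.≤-trans w≤1+N (ℕₚ.≰⇒> w'≰N)

⌈d/i⌉≤w : ∀ d i w → d ≤ w ℕ.* suc i → ceilDiv d (suc i) ≤ w
⌈d/i⌉≤w d i w d≤wi = ℕ.s≤s⁻¹ (m<n*o⇒m/o<n (s≤s (begin
  d ℕ.+ i           ≡⟨ ℕₚ.+-comm d i ⟩
  i ℕ.+ d           ≤⟨ ℕₚ.+-monoʳ-≤ i d≤wi ⟩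
  i ℕ.+ w ℕ.* suc i ∎)))
  where open ℕₚ.≤-Reasoning

d≤⌈d/i⌉*i : ∀ d i → d ≤ ceilDiv d (suc i) ℕ.* suc i
d≤⌈d/i⌉*i d i = ℕₚ.+-cancelʳ-≤ i d _ (begin
  d ℕ.+ i                                      ≡⟨ m≡m%n+[m/n]*n (d ℕ.+ i) (suc i) ⟩
  (d ℕ.+ i) % suc i ℕ.+ ceilDiv d (suc i) ℕ.* suc i ≤⟨ ℕₚ.+-monoˡ-≤ _ (ℕ.s≤s⁻¹ (m%n<n (d ℕ.+ i) (suc i))) ⟩
  i ℕ.+ ceilDiv d (suc i) ℕ.* suc i           ≡⟨ ℕₚ.+-comm i _ ⟩
  ceilDiv d (suc i) ℕ.* suc i ℕ.+ i           ∎)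
  where open ℕₚ.≤-Reasoning

module FieldSums {c ℓ : Level} (F : Field c ℓ) where

  open Field F hiding (zero)
  open import Relation.Binary.Reasoning.Setoid setoid
  open import Algebra.Solver.Ring.NaturalCoefficients.Default commutativeSemiring
    using (solve; _:=_; _:+_)

  sum : (r : ℕ) → (Fin r → Carrier) → Carrier
  sum = sumF F

  sum-cong : ∀ r {f g : Fin r → Carrier} → (∀ t → f t ≈ g t) → sum r f ≈ sum r g
  sum-cong zero    f≈g = refl
  sum-cong (suc r) f≈g = +-cong (f≈g zero) (sum-cong r (f≈g ∘ suc))

  sum-zero : ∀ r {f : Fin r → Carrier} → (∀ t → f t ≈ 0#) → sum r f ≈ 0#
  sum-zero zero    f≈0 = refl
  sum-zero (suc r) f≈0 = trans (+-cong (f≈0 zero) (sum-zero r (f≈0 ∘ suc))) (+-identityʳ 0#)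

  sum-+ : ∀ r (f g : Fin r → Carrier) → sum r (λ t → f t + g t) ≈ sum r f + sum r g
  sum-+ zero    f g = sym (+-identityʳ 0#)
  sum-+ (suc r) f g = trans (+-congˡ (sum-+ r (f ∘ suc) (g ∘ suc)))
    (solve 4 (λ a b c d → (a :+ b) :+ (c :+ d) := (a :+ c) :+ (b :+ d)) refl
       (f zero) (g zero) (sum r (f ∘ suc)) (sum r (g ∘ suc)))

  *-distribˡ-sum : ∀ r x (f : Fin r → Carrier) → x * sum r f ≈ sum r (λ t → x * f t)
  *-distribˡ-sum zero    x f = zeroʳ x
  *-distribˡ-sum (suc r) x f = trans (distribˡ x _ _) (+-congˡ (*-distribˡ-sum r x (f ∘ suc)))

  *-distribʳ-sum : ∀ r x (f : Fin r → Carrier) → sum r f * x ≈ sum r (λ t → f t * x)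
  *-distribʳ-sum r x f =
    trans (*-comm _ x) (trans (*-distribˡ-sum r x f) (sum-cong r (λ t → *-comm x (f t))))

  sum-comm : ∀ r p (f : Fin r → Fin p → Carrier) →
    sum r (λ t → sum p (f t)) ≈ sum p (λ u → sum r (λ t → f t u))
  sum-comm zero    p f = sym (sum-zero p (λ _ → refl))
  sum-comm (suc r) p f = trans (+-congˡ (sum-comm r p (f ∘ suc))) (sym (sum-+ p (f zero) _))

  sum-punchIn : ∀ p (t₀ : Fin (suc p)) (f : Fin (suc p) → Carrier) →
    sum (suc p) f ≈ f t₀ + sum p (f ∘ punchIn t₀)
  sum-punchIn p       zero      f = refl
  sum-punchIn (suc p) (suc t₀) f = trans (+-congˡ (sum-punchIn p t₀ (f ∘ suc)))
    (solve 3 (λ a b d → a :+ (b :+ d) := b :+ (a :+ d)) refl _ _ _)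

  sum-split : ∀ m p (f : Fin (m ℕ.+ p) → Carrier) →
    sum (m ℕ.+ p) f ≈ sum m (f ∘ (_↑ˡ p)) + sum p (f ∘ (m ↑ʳ_))
  sum-split zero    p f = sym (+-identityˡ _)
  sum-split (suc m) p f = trans (+-congˡ (sum-split m p (f ∘ suc))) (sym (+-assoc _ _ _))

  sum-++ : ∀ m p (f g : Fin m → Carrier) (f' g' : Fin p → Carrier) →
    sum (m ℕ.+ p) (λ t → (f ++ f') t * (g ++ g') t) ≈ sum m (λ t → f t * g t) + sum p (λ t → f' t * g' t)
  sum-++ m p f g f' g' = trans (sum-split m p _) (+-cong
    (sum-cong m (λ t → *-cong (reflexive (lookup-++ˡ f f' t)) (reflexive (lookup-++ˡ g g' t))))
    (sum-cong p (λ t → *-cong (reflexive (lookup-++ʳ f f' t)) (reflexive (lookup-++ʳ g g' t)))))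

  δ : ∀ {r} → Fin r → Fin r → Carrier
  δ zero    zero    = 1#
  δ zero    (suc _) = 0#
  δ (suc _) zero    = 0#
  δ (suc t) (suc u) = δ t u

  δ-diag : ∀ {r} (t : Fin r) → δ t t ≈ 1#
  δ-diag zero    = refl
  δ-diag (suc t) = δ-diag t

  δ-sym : ∀ {r} (t u : Fin r) → δ t u ≡ δ u t
  δ-sym zero    zero    = ≡.refl
  δ-sym zero    (suc u) = ≡.refl
  δ-sym (suc t) zero    = ≡.refl
  δ-sym (suc t) (suc u) = δ-sym t u

  δ-↑ˡ : ∀ {m} p (t u : Fin m) → δ (t ↑ˡ p) (u ↑ˡ p) ≡ δ t u
  δ-↑ˡ p zero    zero    = ≡.refl
  δ-↑ˡ p zero    (suc u) = ≡.refl
  δ-↑ˡ p (suc t) zero    = ≡.refl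
  δ-↑ˡ p (suc t) (suc u) = δ-↑ˡ p t u

  δ-↑ʳ : ∀ m {p} (t u : Fin p) → δ (m ↑ʳ t) (m ↑ʳ u) ≡ δ t u
  δ-↑ʳ zero    t u = ≡.refl
  δ-↑ʳ (suc m) t u = δ-↑ʳ m t u

  sum-δ : ∀ r (t : Fin r) (f : Fin r → Carrier) → sum r (λ u → δ t u * f u) ≈ f t
  sum-δ (suc r) zero f = trans
    (+-cong (*-identityˡ _) (sum-zero r (λ u → zeroˡ _))) (+-identityʳ _)
  sum-δ (suc r) (suc t) f = trans
    (+-cong (zeroˡ _) (sum-δ r t (f ∘ suc))) (+-identityˡ _)

  x*y≈0⇒x≈0 : ∀ {x y} → x * y ≈ 0# → ¬ (y ≈ 0#) → x ≈ 0#
  x*y≈0⇒x≈0 {x} {y} xy≈0 y≉0 = let (y⁻¹ , yy⁻¹≈1) = inverse y y≉0 in begin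
    x              ≈⟨ sym (*-identityʳ x) ⟩
    x * 1#         ≈⟨ *-congˡ (sym yy⁻¹≈1) ⟩
    x * (y * y⁻¹)  ≈⟨ sym (*-assoc _ _ _) ⟩
    (x * y) * y⁻¹  ≈⟨ *-congʳ xy≈0 ⟩
    0# * y⁻¹       ≈⟨ zeroˡ y⁻¹ ⟩
    0#             ∎

module SubfieldLinearAlgebra {c ℓ : Level} (F : Field c ℓ) (_≟_ : Decidable (Field._≈_ F))
  (S : Pred (Field.Carrier F) (c ⊔ ℓ)) (S-subfield : IsSubfield F S) where

  open Field F hiding (zero)
  open FieldSums F
  open IsSubfield S-subfield using () renaming
    (zero∈ to S-0; one∈ to S-1; +-cl to S-+; *-cl to S-*; neg-cl to S-neg; inv-cl to S-inv)
  open import Relation.Binary.Reasoning.Setoid setoid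
  open import Algebra.Solver.Ring.NaturalCoefficients.Default commutativeSemiring
    using (solve; _:=_; _:+_; _:*_)
  open import Algebra.Properties.Ring ring using (-‿distribˡ-*; -1*x≈-x; +-inverseˡ-unique)

  Span : ∀ {n r} → (Fin r → Vec F n) → Vec F n → Set (c ⊔ ℓ)
  Span {n} {r} g x = Σ (Fin r → Carrier) λ a →
    (∀ t → S (a t)) × (∀ s → x s ≈ sum r (λ t → a t * g t s))

  Independent : ∀ {n r} → (Fin r → Vec F n) → Set (c ⊔ ℓ)
  Independent {n} {r} g = ∀ (a : Fin r → Carrier) → (∀ t → S (a t)) →
    (∀ s → sum r (λ t → a t * g t s) ≈ 0#) → ∀ t → a t ≈ 0#

  S-sum : ∀ r {f : Fin r → Carrier} → (∀ t → S (f t)) → S (sum r f)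
  S-sum zero    Sf = S-0
  S-sum (suc r) Sf = S-+ (Sf zero) (S-sum r (Sf ∘ suc))

  S-δ : ∀ {r} (t u : Fin r) → S (δ t u)
  S-δ zero    zero    = S-1
  S-δ zero    (suc u) = S-0
  S-δ (suc t) zero    = S-0
  S-δ (suc t) (suc u) = S-δ t u

  Span-generator : ∀ {n r} (g : Fin r → Vec F n) t → Span g (g t)
  Span-generator {r = r} g t = δ t , S-δ t , λ s → sym (sum-δ r t (λ u → g u s))

  Span-∷ : ∀ {n r} (v : Vec F n) (g : Fin r → Vec F n) {x} → Span g x → Span (v ∷ g) x
  Span-∷ v g (a , Sa , x≈ga) = (0# ∷ a) , (λ { zero → S-0 ; (suc t) → Sa t }) ,
    λ s → trans (x≈ga s) (sym (trans (+-congʳ (zeroˡ (v s))) (+-identityˡ _)))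

  Span-trans : ∀ {n r p} {g : Fin r → Vec F n} {h : Fin p → Vec F n} {x} →
    (∀ t → Span h (g t)) → Span g x → Span h x
  Span-trans {n} {r} {p} {g} {h} {x} g⊆h (a , Sa , x≈ag) =
    (λ u → sum r (λ t → a t * b t u)) ,
    (λ u → S-sum r (λ t → S-* (Sa t) (proj₁ (proj₂ (g⊆h t)) u))) ,
    λ s → begin
      x s                                                 ≈⟨ x≈ag s ⟩
      sum r (λ t → a t * g t s)                           ≈⟨ sum-cong r (λ t → *-congˡ (proj₂ (proj₂ (g⊆h t)) s)) ⟩
      sum r (λ t → a t * sum p (λ u → b t u * h u s))     ≈⟨ sum-cong r (λ t → *-distribˡ-sum p (a t) _) ⟩
      sum r (λ t → sum p (λ u → a t * (b t u * h u s)))   ≈⟨ sum-comm r p _ ⟩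
      sum p (λ u → sum r (λ t → a t * (b t u * h u s)))   ≈⟨ sum-cong p (λ u → sum-cong r (λ t → sym (*-assoc _ _ _))) ⟩
      sum p (λ u → sum r (λ t → (a t * b t u) * h u s))   ≈⟨ sum-cong p (λ u → sym (*-distribʳ-sum r (h u s) _)) ⟩
      sum p (λ u → sum r (λ t → a t * b t u) * h u s)     ∎
    where
    b : Fin r → Fin p → Carrier
    b t = proj₁ (g⊆h t)

  Independent-tail : ∀ {n p} (y : Fin (suc p) → Vec F n) → Independent y → Independent (y ∘ suc)
  Independent-tail y y-indep a Sa ay≈0 t = y-indep (0# ∷ a) (λ { zero → S-0 ; (suc t) → Sa t })
    (λ s → trans (trans (+-congʳ (zeroˡ _)) (+-identityˡ _)) (ay≈0 s)) (suc t)

  Independent⇒nonzero : ∀ {n p} (y : Fin p → Vec F n) → Independent y → ∀ t → ¬ (∀ s → y t s ≈ 0#)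
  Independent⇒nonzero {p = p} y y-indep t yt≈0 = 1≉0 (trans (sym (δ-diag t))
    (y-indep (δ t) (S-δ t) (λ s → trans (sum-δ p t (λ u → y u s)) (yt≈0 s)) t))

  Independent-↑ʳ : ∀ {n} m {p} (y : Fin (m ℕ.+ p) → Vec F n) → Independent y → Independent (y ∘ (m ↑ʳ_))
  Independent-↑ʳ zero    y y-indep = y-indep
  Independent-↑ʳ (suc m) y y-indep = Independent-↑ʳ m (y ∘ suc) (Independent-tail y y-indep)

  Independent-↑ˡ : ∀ {n m} p (y : Fin (m ℕ.+ p) → Vec F n) → Independent y → Independent (y ∘ (_↑ˡ p))
  Independent-↑ˡ {n} {m} p y y-indep a Sa ay≈0 t =
    ≡.subst (_≈ 0#) (lookup-++ˡ a 0s t) (y-indep (a ++ 0s) (++⁺ S Sa (λ _ → S-0)) padded≈0 (t ↑ˡ p))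
    where
    0s : Fin p → Carrier
    0s _ = 0#
    padded≈0 : ∀ s → sum (m ℕ.+ p) (λ t → (a ++ 0s) t * y t s) ≈ 0#
    padded≈0 s = trans (sum-split m p _) (trans
      (+-cong (sum-cong m (λ t → *-congʳ (reflexive (lookup-++ˡ a 0s t))))
              (sum-zero p (λ t → trans (*-congʳ (reflexive (lookup-++ʳ a 0s t))) (zeroˡ _))))
      (trans (+-identityʳ _) (ay≈0 s)))

  -- Steinitz exchange step: some y s₀ with a nonzero x zero-coordinate eliminates x zero from
  -- all the other y s.
  eliminate : ∀ {n w p} (x : Fin (suc w) → Vec F n) (y : Fin (suc p) → Vec F n) → (∀ s → Span x (y s)) →
    Σ (Fin (suc p)) λ s₀ → Σ (Fin p → Carrier) λ μ → (∀ j → S (μ j)) ×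
      (∀ j → Span (x ∘ suc) (λ u → y (punchIn s₀ j) u + μ j * y s₀ u))
  eliminate {n} {w} {p} x y y⊆x with any? (λ s → ¬? (proj₁ (y⊆x s) zero ≟ 0#))
  ... | yes (s₀ , A₀≉0) = s₀ , μ , Sμ , reduced
    where
    A : Fin (suc p) → Fin (suc w) → Carrier
    A s = proj₁ (y⊆x s)
    SA : ∀ s t → S (A s t)
    SA s = proj₁ (proj₂ (y⊆x s))
    A₀⁻¹ : Carrier
    A₀⁻¹ = proj₁ (inverse (A s₀ zero) A₀≉0)
    A₀A₀⁻¹≈1 : A s₀ zero * A₀⁻¹ ≈ 1#
    A₀A₀⁻¹≈1 = proj₂ (inverse (A s₀ zero) A₀≉0)
    μ : Fin p → Carrier
    μ j = - (A (punchIn s₀ j) zero * A₀⁻¹)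
    Sμ : ∀ j → S (μ j)
    Sμ j = S-neg (S-* (SA _ zero) (S-inv (SA s₀ zero) A₀A₀⁻¹≈1))
    cancels : ∀ j → A (punchIn s₀ j) zero + μ j * A s₀ zero ≈ 0#
    cancels j = let a = A (punchIn s₀ j) zero in begin
      a + μ j * A s₀ zero                ≈⟨ +-congˡ (sym (-‿distribˡ-* (a * A₀⁻¹) (A s₀ zero))) ⟩
      a + - ((a * A₀⁻¹) * A s₀ zero)     ≈⟨ +-congˡ (-‿cong (trans (*-assoc _ _ _) (*-congˡ (trans (*-comm _ _) A₀A₀⁻¹≈1)))) ⟩
      a + - (a * 1#)                     ≈⟨ +-congˡ (-‿cong (*-identityʳ a)) ⟩
      a + - a                            ≈⟨ -‿inverseʳ a ⟩
      0#                                 ∎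
    reduced : ∀ j → Span (x ∘ suc) (λ u → y (punchIn s₀ j) u + μ j * y s₀ u)
    reduced j = (λ t → A (punchIn s₀ j) (suc t) + μ j * A s₀ (suc t)) ,
                (λ t → S-+ (SA _ (suc t)) (S-* (Sμ j) (SA s₀ (suc t)))) , λ u →
      let a = A (punchIn s₀ j) zero
          R = sum w (λ t → A (punchIn s₀ j) (suc t) * x (suc t) u)
          R₀ = sum w (λ t → A s₀ (suc t) * x (suc t) u) in
      begin
      y (punchIn s₀ j) u + μ j * y s₀ u
        ≈⟨ +-cong (proj₂ (proj₂ (y⊆x (punchIn s₀ j))) u) (*-congˡ (proj₂ (proj₂ (y⊆x s₀)) u)) ⟩
      (a * x zero u + R) + μ j * (A s₀ zero * x zero u + R₀)
        ≈⟨ solve 6 (λ a m a₀ X R R₀ → (a :* X :+ R) :+ m :* (a₀ :* X :+ R₀)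
                   := (a :+ m :* a₀) :* X :+ (R :+ m :* R₀)) refl a (μ j) (A s₀ zero) (x zero u) R R₀ ⟩
      (a + μ j * A s₀ zero) * x zero u + (R + μ j * R₀)
        ≈⟨ +-congʳ (trans (*-congʳ (cancels j)) (zeroˡ _)) ⟩
      0# + (R + μ j * R₀)
        ≈⟨ +-identityˡ _ ⟩
      R + μ j * R₀
        ≈⟨ +-congˡ (*-distribˡ-sum w (μ j) _) ⟩
      R + sum w (λ t → μ j * (A s₀ (suc t) * x (suc t) u))
        ≈⟨ sym (sum-+ w _ _) ⟩
      sum w (λ t → A (punchIn s₀ j) (suc t) * x (suc t) u + μ j * (A s₀ (suc t) * x (suc t) u))
        ≈⟨ sum-cong w (λ t → solve 4 (λ a m b z → a :* z :+ m :* (b :* z) := (a :+ m :* b) :* z) refl _ _ _ _) ⟩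
      sum w (λ t → (A (punchIn s₀ j) (suc t) + μ j * A s₀ (suc t)) * x (suc t) u) ∎
  ... | no none = zero , (λ _ → 0#) , (λ _ → S-0) , reduced
    where
    A : Fin (suc p) → Fin (suc w) → Carrier
    A s = proj₁ (y⊆x s)
    A₀≈0 : ∀ s → A s zero ≈ 0#
    A₀≈0 s with A s zero ≟ 0#
    ... | yes A≈0 = A≈0
    ... | no  A≉0 = contradiction (s , A≉0) none
    reduced : ∀ j → Span (x ∘ suc) (λ u → y (suc j) u + 0# * y zero u)
    reduced j = (λ t → A (suc j) (suc t)) , (λ t → proj₁ (proj₂ (y⊆x (suc j))) (suc t)) , λ u → begin
      y (suc j) u + 0# * y zero u
        ≈⟨ trans (+-congˡ (zeroˡ _)) (+-identityʳ _) ⟩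
      y (suc j) u
        ≈⟨ proj₂ (proj₂ (y⊆x (suc j))) u ⟩
      A (suc j) zero * x zero u + sum w (λ t → A (suc j) (suc t) * x (suc t) u)
        ≈⟨ trans (+-congʳ (trans (*-congʳ (A₀≈0 (suc j))) (zeroˡ _))) (+-identityˡ _) ⟩
      sum w (λ t → A (suc j) (suc t) * x (suc t) u) ∎

  Independent-eliminate : ∀ {n p} (y : Fin (suc p) → Vec F n) (s₀ : Fin (suc p)) (μ : Fin p → Carrier) →
    (∀ j → S (μ j)) → Independent y →
    Independent (λ j u → y (punchIn s₀ j) u + μ j * y s₀ u)
  Independent-eliminate {n} {p} y s₀ μ Sμ y-indep b Sb by≈0 j =
    ≡.subst (_≈ 0#) (insertAt-punchIn b s₀ m j) (y-indep e Se ey≈0 (punchIn s₀ j))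
    where
    m : Carrier
    m = sum p (λ j → b j * μ j)
    e : Fin (suc p) → Carrier
    e = insertAt b s₀ m
    Se : ∀ t → S (e t)
    Se t with s₀ Fin.≟ t
    ... | yes ≡.refl = ≡.subst S (≡.sym (insertAt-lookup b s₀ m)) (S-sum p (λ j → S-* (Sb j) (Sμ j)))
    ... | no  s₀≢t   = ≡.subst S
      (≡.trans (≡.sym (insertAt-punchIn b s₀ m (Fin.punchOut s₀≢t))) (≡.cong e (Finₚ.punchIn-punchOut s₀≢t)))
      (Sb (Fin.punchOut s₀≢t))
    ey≈0 : ∀ u → sum (suc p) (λ t → e t * y t u) ≈ 0#
    ey≈0 u = begin
      sum (suc p) (λ t → e t * y t u)
        ≈⟨ sum-punchIn p s₀ (λ t → e t * y t u) ⟩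
      e s₀ * y s₀ u + sum p (λ j → e (punchIn s₀ j) * y (punchIn s₀ j) u)
        ≈⟨ +-cong (*-congʳ (reflexive (insertAt-lookup b s₀ m)))
                  (sum-cong p (λ j → *-congʳ (reflexive (insertAt-punchIn b s₀ m j)))) ⟩
      m * y s₀ u + sum p (λ j → b j * y (punchIn s₀ j) u)
        ≈⟨ +-congʳ (*-distribʳ-sum p (y s₀ u) _) ⟩
      sum p (λ j → (b j * μ j) * y s₀ u) + sum p (λ j → b j * y (punchIn s₀ j) u)
        ≈⟨ sym (sum-+ p _ _) ⟩
      sum p (λ j → (b j * μ j) * y s₀ u + b j * y (punchIn s₀ j) u)
        ≈⟨ sum-cong p (λ j → solve 4 (λ B M Y Z → (B :* M) :* Y :+ B :* Z := B :* (Z :+ M :* Y)) refl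
                                (b j) (μ j) (y s₀ u) (y (punchIn s₀ j) u)) ⟩
      sum p (λ j → b j * (y (punchIn s₀ j) u + μ j * y s₀ u))
        ≈⟨ by≈0 u ⟩
      0# ∎

  Independent⇒≤ : ∀ {n} w p (x : Fin w → Vec F n) (y : Fin p → Vec F n) →
    (∀ s → Span x (y s)) → Independent y → p ≤ w
  Independent⇒≤ w       zero    x y y⊆x y-indep = z≤n
  Independent⇒≤ zero    (suc p) x y y⊆x y-indep =
    contradiction (proj₂ (proj₂ (y⊆x zero))) (Independent⇒nonzero y y-indep zero)
  Independent⇒≤ (suc w) (suc p) x y y⊆x y-indep =
    let (s₀ , μ , Sμ , reduced) = eliminate x y y⊆x in
    s≤s (Independent⇒≤ w p (x ∘ suc) _ reduced (Independent-eliminate y s₀ μ Sμ y-indep))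

  record SubBasis {n N} (g : Fin N → Vec F n) : Set (c ⊔ ℓ) where
    field
      size        : ℕ
      basis       : Fin size → Vec F n
      size≤       : size ≤ N
      generator   : ∀ t → Σ (Fin N) λ u → basis t ≡ g u
      independent : Independent basis
      spanning    : ∀ u → Span basis (g u)

  module _ (Span? : ∀ {n r} (b : Fin r → Vec F n) x → Dec (Span b x)) where

    subBasis : ∀ {n} N (g : Fin N → Vec F n) → SubBasis g
    subBasis zero g = record
      { size = 0 ; basis = λ () ; size≤ = z≤n ; generator = λ () ; independent = λ _ _ _ () ; spanning = λ () }
    subBasis (suc N) g with subBasis N (g ∘ suc)
    ... | B with Span? (SubBasis.basis B) (g zero)
    ...   | yes g₀∈B = record
      { size = size ; basis = basis ; size≤ = ℕₚ.m≤n⇒m≤1+n size≤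
      ; generator = λ t → suc (proj₁ (generator t)) , proj₂ (generator t)
      ; independent = independent
      ; spanning = λ { zero → g₀∈B ; (suc u) → spanning u } }
      where open SubBasis B
    ...   | no g₀∉B = record
      { size = suc size ; basis = g zero ∷ basis ; size≤ = s≤s size≤
      ; generator = λ { zero → zero , ≡.refl ; (suc t) → suc (proj₁ (generator t)) , proj₂ (generator t) }
      ; independent = independent′
      ; spanning = λ { zero → Span-generator (g zero ∷ basis) zero ; (suc u) → Span-∷ (g zero) basis (spanning u) } }
      where
      open SubBasis B
      independent′ : Independent (g zero ∷ basis)
      independent′ a Sa a·g≈0 = a≈0
        where
        a₀≈0 : a zero ≈ 0#
        a₀≈0 with a zero ≟ 0#
        ... | yes a₀≈0 = a₀≈0
        ... | no  a₀≉0 = contradiction g₀∈B g₀∉B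
          where
          a₀⁻¹ = proj₁ (inverse (a zero) a₀≉0)
          a₀a₀⁻¹≈1 : a zero * a₀⁻¹ ≈ 1#
          a₀a₀⁻¹≈1 = proj₂ (inverse (a zero) a₀≉0)
          g₀∈B : Span basis (g zero)
          g₀∈B = (λ t → - (a₀⁻¹ * a (suc t))) ,
                 (λ t → S-neg (S-* (S-inv (Sa zero) a₀a₀⁻¹≈1) (Sa (suc t)))) , λ s →
            let R = sum size (λ t → a (suc t) * basis t s) in begin
            g zero s                                      ≈⟨ sym (*-identityˡ _) ⟩
            1# * g zero s                                 ≈⟨ *-congʳ (sym (trans (*-comm _ _) a₀a₀⁻¹≈1)) ⟩
            (a₀⁻¹ * a zero) * g zero s                    ≈⟨ *-assoc _ _ _ ⟩
            a₀⁻¹ * (a zero * g zero s)                    ≈⟨ *-congˡ (+-inverseˡ-unique _ _ (a·g≈0 s)) ⟩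
            a₀⁻¹ * (- R)                                  ≈⟨ *-congˡ (sym (-1*x≈-x R)) ⟩
            a₀⁻¹ * (- 1# * R)                             ≈⟨ *-congˡ (*-distribˡ-sum size (- 1#) _) ⟩
            a₀⁻¹ * sum size (λ t → - 1# * (a (suc t) * basis t s))
                                                          ≈⟨ *-distribˡ-sum size a₀⁻¹ _ ⟩
            sum size (λ t → a₀⁻¹ * (- 1# * (a (suc t) * basis t s)))
              ≈⟨ sum-cong size (λ t → trans
                   (solve 4 (λ I M A B → I :* (M :* (A :* B)) := M :* (I :* A) :* B) refl a₀⁻¹ (- 1#) (a (suc t)) (basis t s))
                   (*-congʳ (-1*x≈-x _))) ⟩
            sum size (λ t → - (a₀⁻¹ * a (suc t)) * basis t s) ∎
        a≈0 : ∀ t → a t ≈ 0#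
        a≈0 zero    = a₀≈0
        a≈0 (suc t) = independent (a ∘ suc) (Sa ∘ suc) (λ s →
          trans (sym (+-identityˡ _)) (trans (+-congʳ (sym (trans (*-congʳ a₀≈0) (zeroˡ _)))) (a·g≈0 s))) t

module FiniteFieldSearch {c ℓ : Level} (F : Field c ℓ) {N : ℕ} (F-finite : HasCard F (λ _ → ⊤) N) where

  open Field F hiding (zero)

  private
    enum : Fin N → Carrier
    enum = proj₁ F-finite

    enum-injective : ∀ t t' → enum t ≈ enum t' → t ≡ t'
    enum-injective = proj₁ (proj₂ (proj₂ F-finite))

    index : Carrier → Fin N
    index x = proj₁ (proj₂ (proj₂ (proj₂ F-finite)) x tt)

    x≈enum-index : ∀ x → x ≈ enum (index x)
    x≈enum-index x = proj₂ (proj₂ (proj₂ (proj₂ F-finite)) x tt)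

  _≟_ : Decidable _≈_
  x ≟ y with index x Fin.≟ index y
  ... | yes i≡j = yes (trans (x≈enum-index x) (trans (reflexive (≡.cong enum i≡j)) (sym (x≈enum-index y))))
  ... | no  i≢j = no λ x≈y → i≢j (enum-injective (index x) (index y)
                        (trans (sym (x≈enum-index x)) (trans x≈y (x≈enum-index y))))

  Respects≈ : ∀ {r p} → Pred (Fin r → Carrier) p → Set (c ⊔ ℓ ⊔ p)
  Respects≈ {r} Q = ∀ f g → (∀ t → f t ≈ g t) → Q f → Q g

  private
    Respects≈-∷ : ∀ {r p} (Q : Pred (Fin (suc r) → Carrier) p) → Respects≈ Q → ∀ x →
      Respects≈ (λ f → Q (x ∷ f))
    Respects≈-∷ Q Q-resp x f g f≈g = Q-resp _ _ λ { zero → refl ; (suc t) → f≈g t }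

    enum-index-∷ : ∀ {r} (f : Fin (suc r) → Carrier) t → f t ≈ (enum (index (f zero)) ∷ f ∘ suc) t
    enum-index-∷ f zero    = x≈enum-index (f zero)
    enum-index-∷ f (suc t) = refl

  ∃? : ∀ {p} r (Q : Pred (Fin r → Carrier) p) → Respects≈ Q → U.Decidable Q → Dec (Σ (Fin r → Carrier) Q)
  ∃? zero Q Q-resp Q? with Q? (λ ())
  ... | yes q  = yes (_ , q)
  ... | no ¬q  = no λ (f , q) → ¬q (Q-resp f _ (λ ()) q)
  ∃? (suc r) Q Q-resp Q? with any? (λ x → ∃? r (λ f → Q (enum x ∷ f)) (Respects≈-∷ Q Q-resp _) (Q? ∘ (enum x ∷_)))
  ... | yes (_ , _ , q) = yes (_ , q)
  ... | no  none        = no λ (f , q) → none (index (f zero) , f ∘ suc , Q-resp f _ (enum-index-∷ f) q)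

  ∀? : ∀ {p} r (Q : Pred (Fin r → Carrier) p) → Respects≈ Q → U.Decidable Q → Dec (∀ f → Q f)
  ∀? zero Q Q-resp Q? with Q? (λ ())
  ... | yes q = yes λ f → Q-resp _ f (λ ()) q
  ... | no ¬q = no λ all → ¬q (all _)
  ∀? (suc r) Q Q-resp Q? with all? (λ x → ∀? r (λ f → Q (enum x ∷ f)) (Respects≈-∷ Q Q-resp _) (Q? ∘ (enum x ∷_)))
  ... | yes all = yes λ f → Q-resp _ f (λ t → sym (enum-index-∷ f t)) (all (index (f zero)) (f ∘ suc))
  ... | no ¬all = no λ all → ¬all λ x f → all _

module Rank {c ℓ : Level} (F : Field c ℓ) (K : Pred (Field.Carrier F) (c ⊔ ℓ)) (K-subfield : IsSubfield F K)
  {N : ℕ} (F-finite : HasCard F (λ _ → ⊤) N) {q : ℕ} (K-finite : HasCard F K q) where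

  open Field F hiding (zero)
  open FieldSums F
  open FiniteFieldSearch F F-finite public
  open IsSubfield K-subfield using () renaming
    (resp to K-resp; +-cl to K-+; *-cl to K-*; neg-cl to K-neg)
  open import Relation.Binary.Reasoning.Setoid setoid
  open import Algebra.Solver.Ring.NaturalCoefficients.Default commutativeSemiring
    using (solve; _:=_; _:*_)
  open import Algebra.Properties.Ring ring using (-‿distribˡ-*; -1*x≈-x; x∙y⁻¹≈ε⇒x≈y)

  K? : U.Decidable K
  K? x with any? (λ t → x ≟ proj₁ K-finite t)
  ... | yes (t , x≈t) = yes (K-resp (sym x≈t) (proj₁ (proj₂ K-finite) t))
  ... | no  none      = no λ Kx → none (proj₂ (proj₂ (proj₂ K-finite)) x Kx)

  ⊤-subfield : IsSubfield F (λ _ → ⊤)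
  ⊤-subfield = record
    { resp = λ _ _ → tt ; zero∈ = tt ; one∈ = tt ; +-cl = λ _ _ → tt
    ; *-cl = λ _ _ → tt ; neg-cl = λ _ → tt ; inv-cl = λ _ _ → tt }

  module FL = SubfieldLinearAlgebra F _≟_ (λ _ → ⊤) ⊤-subfield
  module KL = SubfieldLinearAlgebra F _≟_ K K-subfield

  FL-Span? : ∀ {n r} (b : Fin r → Vec F n) x → Dec (FL.Span b x)
  FL-Span? {n} {r} b x = ∃? r _
    (λ f g f≈g (_ , x≈fb) → (λ _ → tt) , λ s → trans (x≈fb s) (sum-cong r (λ t → *-congʳ (f≈g t))))
    (λ f → yes (λ _ → tt) ×-dec all? (λ s → x s ≟ sum r (λ t → f t * b t s)))

  KL-Span? : ∀ {n r} (b : Fin r → Vec F n) x → Dec (KL.Span b x)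
  KL-Span? {n} {r} b x = ∃? r _
    (λ f g f≈g (Kf , x≈fb) → (λ t → K-resp (f≈g t) (Kf t)) , λ s → trans (x≈fb s) (sum-cong r (λ t → *-congʳ (f≈g t))))
    (λ f → all? (λ t → K? (f t)) ×-dec all? (λ s → x s ≟ sum r (λ t → f t * b t s)))

  InSpan⇒Span : ∀ {n r} {g : Fin r → Vec F n} {x} → InSpan F g x → FL.Span g x
  InSpan⇒Span (a , x≈ag) = a , (λ _ → tt) , x≈ag

  Span⇒InSpan : ∀ {n r} {g : Fin r → Vec F n} {x} → FL.Span g x → InSpan F g x
  Span⇒InSpan (a , _ , x≈ag) = a , x≈ag

  LinIndep⇒Independent : ∀ {n r} {g : Fin r → Vec F n} → LinIndep F g → FL.Independent g
  LinIndep⇒Independent g-indep a _ = g-indep a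

  Independent⇒LinIndep : ∀ {n r} {g : Fin r → Vec F n} → FL.Independent g → LinIndep F g
  Independent⇒LinIndep g-indep a = g-indep a (λ _ → tt)

  KIndep⇒Independent : ∀ {r} {b : Fin r → Carrier} → KIndep F K b → KL.Independent (λ t (_ : Fin 1) → b t)
  KIndep⇒Independent b-indep a Ka ab≈0 = b-indep a Ka (ab≈0 zero)

  InSpan-generator : ∀ {n r} (g : Fin r → Vec F n) t → InSpan F g (g t)
  InSpan-generator g t = Span⇒InSpan (FL.Span-generator g t)

  InSpan-trans : ∀ {n r p} {g : Fin r → Vec F n} {h : Fin p → Vec F n} {x} →
    (∀ t → InSpan F h (g t)) → InSpan F g x → InSpan F h x
  InSpan-trans g⊆h x∈g = Span⇒InSpan (FL.Span-trans (InSpan⇒Span ∘ g⊆h) (InSpan⇒Span x∈g))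

  InSpan-resp : ∀ {n r} {g : Fin r → Vec F n} {x y} → (∀ s → x s ≈ y s) → InSpan F g x → InSpan F g y
  InSpan-resp x≈y (a , x≈ag) = a , λ s → trans (sym (x≈y s)) (x≈ag s)

  IsSubspace-sum : ∀ {n} {X : Pred (Vec F n) (c ⊔ ℓ)} → IsSubspace F X → ∀ r (a : Fin r → Carrier) (g : Fin r → Vec F n) →
    (∀ t → X (g t)) → X (λ s → sum r (λ t → a t * g t s))
  IsSubspace-sum X-sub zero    a g g∈X = IsSubspace.zero∈ X-sub
  IsSubspace-sum X-sub (suc r) a g g∈X = IsSubspace.+-cl X-sub (IsSubspace.*-cl X-sub (a zero) (g∈X zero))
    (IsSubspace-sum X-sub r (a ∘ suc) (g ∘ suc) (g∈X ∘ suc))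

  InSpan⊆ : ∀ {n r} {X : Pred (Vec F n) (c ⊔ ℓ)} → IsSubspace F X → {g : Fin r → Vec F n} →
    (∀ t → X (g t)) → ∀ {x} → InSpan F g x → X x
  InSpan⊆ {r = r} X-sub {g} g∈X (a , x≈ag) = IsSubspace.resp X-sub (λ s → sym (x≈ag s)) (IsSubspace-sum X-sub r a g g∈X)

  InSpan-isSubspace : ∀ {n r} (g : Fin r → Vec F n) → IsSubspace F (InSpan F g)
  InSpan-isSubspace {n} {r} g = record
    { resp  = InSpan-resp
    ; zero∈ = (λ _ → 0#) , λ s → sym (sum-zero r (λ t → zeroˡ _))
    ; +-cl  = λ (a , x≈ag) (b , y≈bg) → (λ t → a t + b t) , λ s →
        trans (+-cong (x≈ag s) (y≈bg s)) (trans (sym (sum-+ r _ _)) (sum-cong r (λ t → sym (distribʳ _ _ _))))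
    ; *-cl  = λ e (a , x≈ag) → (λ t → e * a t) , λ s →
        trans (*-congˡ (x≈ag s)) (trans (*-distribˡ-sum r e _) (sum-cong r (λ t → sym (*-assoc _ _ _))))
    }

  KIndep⇒nonzero : ∀ {r} (b : Fin r → Carrier) → KIndep F K b → ∀ t → ¬ (b t ≈ 0#)
  KIndep⇒nonzero b b-indep t bt≈0 = KL.Independent⇒nonzero _ (KIndep⇒Independent b-indep) t (λ _ → bt≈0)

  RankAtMost : ∀ {n} → ℕ → Vec F n → Set (c ⊔ ℓ)
  RankAtMost i v = Σ ℕ λ r → r ≤ i × HasRank F K v r

  ∃-rank : ∀ {n} (v : Vec F n) → ∃ (HasRank F K v)
  ∃-rank {n} v = size , (λ t → basis t zero) , (λ a Ka ab≈0 → independent a Ka λ { zero → ab≈0 }) , basis⊆entries , entries⊆basis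
    where
    open KL.SubBasis (KL.subBasis KL-Span? n (λ s (_ : Fin 1) → v s))
    basis⊆entries : ∀ t → InKSpan F K v (basis t zero)
    basis⊆entries t = let (u , eq) = generator t in
      δ u , KL.S-δ u , trans (reflexive (≡.cong (λ f → f zero) eq)) (sym (sum-δ n u v))
    entries⊆basis : ∀ s → InKSpan F K (λ t → basis t zero) (v s)
    entries⊆basis s = let (a , Ka , vs≈ab) = spanning s in a , Ka , vs≈ab zero

  private
    ∑ℕ : ∀ w → (Fin w → ℕ) → ℕ
    ∑ℕ zero    r = 0
    ∑ℕ (suc w) r = r zero ℕ.+ ∑ℕ w (r ∘ suc)

    ∑ℕ≤ : ∀ w (r : Fin w → ℕ) i → (∀ t → r t ≤ i) → ∑ℕ w r ≤ w ℕ.* i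
    ∑ℕ≤ zero    r i r≤i = z≤n
    ∑ℕ≤ (suc w) r i r≤i = ℕₚ.+-mono-≤ (r≤i zero) (∑ℕ≤ w (r ∘ suc) i (r≤i ∘ suc))

    concat : ∀ w (r : Fin w → ℕ) → (∀ t → Fin (r t) → Carrier) → Fin (∑ℕ w r) → Carrier
    concat zero    r f ()
    concat (suc w) r f = f zero ++ concat w (r ∘ suc) (f ∘ suc)

    concat⁺ : ∀ (P : Pred Carrier (c ⊔ ℓ)) w r (f : ∀ t → Fin (r t) → Carrier) →
      (∀ t u → P (f t u)) → ∀ p → P (concat w r f p)
    concat⁺ P zero    r f Pf ()
    concat⁺ P (suc w) r f Pf = ++⁺ P (Pf zero) (concat⁺ P w (r ∘ suc) (f ∘ suc) (Pf ∘ suc))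

    sum-concat : ∀ w r (f g : ∀ t → Fin (r t) → Carrier) →
      sum (∑ℕ w r) (λ p → concat w r f p * concat w r g p) ≈ sum w (λ t → sum (r t) (λ u → f t u * g t u))
    sum-concat zero    r f g = refl
    sum-concat (suc w) r f g = trans (sum-++ (r zero) (∑ℕ w (r ∘ suc)) (f zero) (g zero) _ _)
      (+-congˡ (sum-concat w (r ∘ suc) (f ∘ suc) (g ∘ suc)))

  -- The entries of Σ_t a_t e_t lie in the K-span of the Σ_t rk(e_t) elements a_t β_{t,u}, where
  -- β_t is a K-basis of the entries of e_t.
  rank-InSpan≤ : ∀ {n w} (e : Fin w → Vec F n) i → (∀ t → RankAtMost i (e t)) →
    ∀ {x} → InSpan F e x → ∀ r → HasRank F K x r → r ≤ w ℕ.* i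
  rank-InSpan≤ {n} {w} e i e-rank {x} (a , x≈ae) r (b , b-indep , b⊆x , x⊆b) =
    ℕₚ.≤-trans (KL.Independent⇒≤ (∑ℕ w rk) r γ (λ t _ → b t) b⊆γ (KIndep⇒Independent b-indep))
               (∑ℕ≤ w rk i (λ t → proj₁ (proj₂ (e-rank t))))
    where
    rk : Fin w → ℕ
    rk t = proj₁ (e-rank t)
    β : ∀ t → Fin (rk t) → Carrier
    β t = proj₁ (proj₂ (proj₂ (e-rank t)))
    e⊆β : ∀ t s → InKSpan F K (β t) (e t s)
    e⊆β t = proj₂ (proj₂ (proj₂ (proj₂ (proj₂ (e-rank t)))))
    γ : Fin (∑ℕ w rk) → Vec F 1
    γ p _ = concat w rk (λ t u → a t * β t u) p
    x⊆γ : ∀ s → KL.Span γ (λ _ → x s)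
    x⊆γ s = concat w rk (λ t → proj₁ (e⊆β t s)) ,
            concat⁺ K w rk _ (λ t → proj₁ (proj₂ (e⊆β t s))) , λ _ → begin
      x s                                                         ≈⟨ x≈ae s ⟩
      sum w (λ t → a t * e t s)                                   ≈⟨ sum-cong w (λ t → *-congˡ (proj₂ (proj₂ (e⊆β t s)))) ⟩
      sum w (λ t → a t * sum (rk t) (λ u → κ t s u * β t u))      ≈⟨ sum-cong w (λ t → *-distribˡ-sum (rk t) (a t) _) ⟩
      sum w (λ t → sum (rk t) (λ u → a t * (κ t s u * β t u)))
        ≈⟨ sum-cong w (λ t → sum-cong (rk t) (λ u →
             solve 3 (λ A B C → A :* (B :* C) := B :* (A :* C)) refl (a t) (κ t s u) (β t u))) ⟩
      sum w (λ t → sum (rk t) (λ u → κ t s u * (a t * β t u)))   ≈⟨ sym (sum-concat w rk _ _) ⟩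
      sum (∑ℕ w rk) (λ p → concat w rk (λ t → κ t s) p * γ p zero) ∎
      where
      κ : ∀ t s → Fin (rk t) → Carrier
      κ t s = proj₁ (e⊆β t s)
    b⊆γ : ∀ t → KL.Span γ (λ _ → b t)
    b⊆γ t = KL.Span-trans {g = λ s _ → x s} x⊆γ (let (κ , Kκ , bt≈κx) = b⊆x t in κ , Kκ , λ _ → bt≈κx)

  ⟨_,_⟩ : ∀ {n} → Vec F n → Vec F n → Carrier
  ⟨_,_⟩ {n} κ x = sum n (λ s → κ s * x s)

  ⟨⟩-linearʳ : ∀ {n} r (κ : Vec F n) (a : Fin r → Carrier) (g : Fin r → Vec F n) →
    ⟨ κ , (λ s → sum r (λ t → a t * g t s)) ⟩ ≈ sum r (λ t → a t * ⟨ κ , g t ⟩)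
  ⟨⟩-linearʳ {n} r κ a g = begin
    sum n (λ s → κ s * sum r (λ t → a t * g t s))   ≈⟨ sum-cong n (λ s → *-distribˡ-sum r (κ s) _) ⟩
    sum n (λ s → sum r (λ t → κ s * (a t * g t s)))  ≈⟨ sum-comm n r _ ⟩
    sum r (λ t → sum n (λ s → κ s * (a t * g t s)))
      ≈⟨ sum-cong r (λ t → trans (sum-cong n (λ s → solve 3 (λ K A G → K :* (A :* G) := A :* (K :* G)) refl (κ s) (a t) (g t s)))
                                 (sym (*-distribˡ-sum n (a t) _))) ⟩
    sum r (λ t → a t * ⟨ κ , g t ⟩)                  ∎

  -- A vector of rank r is Σ_t coeff_t basis_t with the coeff_t a K-basis of the K-span of its
  -- entries and K-rational basis_t; the K-rational dual_t express coeff_t as K-combinations of the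
  -- entries, which forces ⟨ dual_t , basis_t' ⟩ = δ_tt'.
  record RankDecomposition (n r : ℕ) : Set (c ⊔ ℓ) where
    field
      coeff             : Fin r → Carrier
      basis             : Fin r → Vec F n
      dual              : Fin r → Vec F n
      coeff-independent : KIndep F K coeff
      basis-rational    : ∀ t s → K (basis t s)
      dual-rational     : ∀ t s → K (dual t s)
      dual-basis        : ∀ t t' → ⟨ dual t , basis t' ⟩ ≈ δ t t'
    vector : Vec F n
    vector s = sum r (λ t → coeff t * basis t s)

    ⟨dual,vector⟩ : ∀ t → ⟨ dual t , vector ⟩ ≈ coeff t
    ⟨dual,vector⟩ t = begin
      ⟨ dual t , vector ⟩                         ≈⟨ ⟨⟩-linearʳ r (dual t) coeff basis ⟩
      sum r (λ t' → coeff t' * ⟨ dual t , basis t' ⟩)  ≈⟨ sum-cong r (λ t' → trans (*-congˡ (dual-basis t t')) (*-comm _ _)) ⟩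
      sum r (λ t' → δ t t' * coeff t')            ≈⟨ sum-δ r t coeff ⟩
      coeff t                                     ∎

    ⟨dual,vector⟩≉0 : ∀ t → ¬ (⟨ dual t , vector ⟩ ≈ 0#)
    ⟨dual,vector⟩≉0 t ≈0 = KIndep⇒nonzero coeff coeff-independent t (trans (sym (⟨dual,vector⟩ t)) ≈0)

    rank : HasRank F K vector r
    rank = coeff , coeff-independent , (λ t → dual t , dual-rational t , sym (⟨dual,vector⟩ t)) ,
      λ s → (λ t → basis t s) , (λ t → basis-rational t s) , sum-cong r (λ t → *-comm _ _)

  rankDecomposition : ∀ {n r} (v : Vec F n) → HasRank F K v r →
    Σ (RankDecomposition n r) λ D → ∀ s → v s ≈ RankDecomposition.vector D s
  rankDecomposition {n} {r} v (b , b-indep , b⊆v , v⊆b) = D , λ s → trans (proj₂ (proj₂ (v⊆b s))) (sum-cong r (λ t → *-comm _ _))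
    where
    κ : Fin r → Vec F n
    κ t = proj₁ (b⊆v t)
    A : Fin n → Fin r → Carrier
    A s = proj₁ (v⊆b s)
    u : Fin r → Vec F n
    u t s = A s t
    M : Fin r → Fin r → Carrier
    M t t' = ⟨ κ t , u t' ⟩
    K-M : ∀ t t' → K (M t t')
    K-M t t' = KL.S-sum n (λ s → K-* (proj₁ (proj₂ (b⊆v t)) s) (proj₁ (proj₂ (v⊆b s)) t'))
    b≈Mb : ∀ t → b t ≈ sum r (λ t' → M t t' * b t')
    b≈Mb t = begin
      b t                                                ≈⟨ proj₂ (proj₂ (b⊆v t)) ⟩
      sum n (λ s → κ t s * v s)                          ≈⟨ sum-cong n (λ s → *-congˡ (proj₂ (proj₂ (v⊆b s)))) ⟩
      sum n (λ s → κ t s * sum r (λ t' → A s t' * b t'))  ≈⟨ sum-cong n (λ s → *-distribˡ-sum r _ _) ⟩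
      sum n (λ s → sum r (λ t' → κ t s * (A s t' * b t'))) ≈⟨ sum-comm n r _ ⟩
      sum r (λ t' → sum n (λ s → κ t s * (A s t' * b t')))
        ≈⟨ sum-cong r (λ t' → trans (sum-cong n (λ s → sym (*-assoc _ _ _))) (sym (*-distribʳ-sum n (b t') _))) ⟩
      sum r (λ t' → M t t' * b t')                        ∎
    M≈δ : ∀ t t' → M t t' ≈ δ t t'
    M≈δ t t' = x∙y⁻¹≈ε⇒x≈y _ _ (b-indep (λ t'' → M t t'' + - δ t t'') (λ t'' → K-+ (K-M t t'') (K-neg (KL.S-δ t t''))) (begin
      sum r (λ t'' → (M t t'' + - δ t t'') * b t'')
        ≈⟨ sum-cong r (λ t'' → trans (distribʳ _ _ _) (+-congˡ (sym (-‿distribˡ-* _ _)))) ⟩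
      sum r (λ t'' → M t t'' * b t'' + - (δ t t'' * b t''))  ≈⟨ sum-+ r _ _ ⟩
      sum r (λ t'' → M t t'' * b t'') + sum r (λ t'' → - (δ t t'' * b t''))
        ≈⟨ +-congˡ (trans (sum-cong r (λ t'' → sym (-1*x≈-x _))) (sym (*-distribˡ-sum r (- 1#) _))) ⟩
      sum r (λ t'' → M t t'' * b t'') + - 1# * sum r (λ t'' → δ t t'' * b t'')
        ≈⟨ +-cong (sym (b≈Mb t)) (trans (*-congˡ (sum-δ r t b)) (-1*x≈-x _)) ⟩
      b t + - b t                                            ≈⟨ -‿inverseʳ _ ⟩
      0#                                                     ∎) t')
    D : RankDecomposition n r
    D = record
      { coeff = b ; basis = u ; dual = κ ; coeff-independent = b-indep
      ; basis-rational = λ t s → proj₁ (proj₂ (v⊆b s)) t ; dual-rational = λ t → proj₁ (proj₂ (b⊆v t))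
      ; dual-basis = M≈δ }

  restrictˡ : ∀ {n m p} → RankDecomposition n (m ℕ.+ p) → RankDecomposition n m
  restrictˡ {n} {m} {p} D = record
    { coeff = coeff ∘ (_↑ˡ p) ; basis = basis ∘ (_↑ˡ p) ; dual = dual ∘ (_↑ˡ p)
    ; coeff-independent = λ a Ka a·coeff≈0 →
        KL.Independent-↑ˡ p _ (KIndep⇒Independent coeff-independent) a Ka (λ _ → a·coeff≈0)
    ; basis-rational = basis-rational ∘ (_↑ˡ p) ; dual-rational = dual-rational ∘ (_↑ˡ p)
    ; dual-basis = λ t t' → trans (dual-basis (t ↑ˡ p) (t' ↑ˡ p)) (reflexive (δ-↑ˡ p t t')) }
    where open RankDecomposition D

  restrictʳ : ∀ {n m p} → RankDecomposition n (m ℕ.+ p) → RankDecomposition n p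
  restrictʳ {n} {m} {p} D = record
    { coeff = coeff ∘ (m ↑ʳ_) ; basis = basis ∘ (m ↑ʳ_) ; dual = dual ∘ (m ↑ʳ_)
    ; coeff-independent = λ a Ka a·coeff≈0 →
        KL.Independent-↑ʳ m _ (KIndep⇒Independent coeff-independent) a Ka (λ _ → a·coeff≈0)
    ; basis-rational = basis-rational ∘ (m ↑ʳ_) ; dual-rational = dual-rational ∘ (m ↑ʳ_)
    ; dual-basis = λ t t' → trans (dual-basis (m ↑ʳ t) (m ↑ʳ t')) (reflexive (δ-↑ʳ m t t')) }
    where open RankDecomposition D

  LinIndep-∷ : ∀ {n w} {x : Vec F n} {z : Fin w → Vec F n} (κ : Vec F n) →
    ¬ (⟨ κ , x ⟩ ≈ 0#) → (∀ t → ⟨ κ , z t ⟩ ≈ 0#) → LinIndep F z → LinIndep F (x ∷ z)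
  LinIndep-∷ {n} {w} {x} {z} κ κx≉0 κz≈0 z-indep a a·xz≈0 = a≈0
    where
    a₀κx≈0 : a zero * ⟨ κ , x ⟩ ≈ 0#
    a₀κx≈0 = begin
      a zero * ⟨ κ , x ⟩                              ≈⟨ sym (+-identityʳ _) ⟩
      a zero * ⟨ κ , x ⟩ + 0#                         ≈⟨ +-congˡ (sym (sum-zero w (λ t → trans (*-congˡ (κz≈0 t)) (zeroʳ _)))) ⟩
      sum (suc w) (λ t → a t * ⟨ κ , (x ∷ z) t ⟩)     ≈⟨ sym (⟨⟩-linearʳ (suc w) κ a (x ∷ z)) ⟩
      ⟨ κ , (λ s → sum (suc w) (λ t → a t * (x ∷ z) t s)) ⟩
                                                      ≈⟨ sum-zero n (λ s → trans (*-congˡ (a·xz≈0 s)) (zeroʳ _)) ⟩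
      0#                                              ∎
    a₀≈0 : a zero ≈ 0#
    a₀≈0 = x*y≈0⇒x≈0 a₀κx≈0 κx≉0
    a≈0 : ∀ t → a t ≈ 0#
    a≈0 zero    = a₀≈0
    a≈0 (suc t) = z-indep (a ∘ suc) (λ s →
      trans (sym (+-identityˡ _)) (trans (+-congʳ (sym (trans (*-congʳ a₀≈0) (zeroˡ _)))) (a·xz≈0 s))) t

  record Cover {n r} (i k : ℕ) (D : RankDecomposition n r) : Set (c ⊔ ℓ) where
    field
      size        : ℕ
      size≤       : size ≤ k
      vectors     : Fin size → Vec F n
      rank≤       : ∀ t → RankAtMost i (vectors t)
      independent : LinIndep F vectors
      covers      : InSpan F vectors (RankDecomposition.vector D)
      inBasisSpan : ∀ t → InSpan F (RankDecomposition.basis D) (vectors t)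

  -- Split the r terms into blocks of i+1 consecutive terms.  The dual vector of the first term
  -- pairs nontrivially with the first block and trivially with the span of the later terms,
  -- which keeps the block vectors independent.
  cover : ∀ {n} i k r → r ≤ k ℕ.* suc i → (D : RankDecomposition n r) → Cover (suc i) k D
  cover i k zero _ D = record
    { size = 0 ; size≤ = z≤n ; vectors = λ () ; rank≤ = λ () ; independent = λ _ _ ()
    ; covers = (λ ()) , λ _ → refl ; inBasisSpan = λ () }
  cover i zero (suc r) () D
  cover {n} i (suc k) (suc r) r≤ki D with suc r ℕₚ.≤? suc i
  ... | yes r≤i = record
    { size = 1 ; size≤ = s≤s z≤n ; vectors = vector ∷ []
    ; rank≤ = λ { zero → suc r , r≤i , rank }
    ; independent = LinIndep-∷ {z = []} (dual zero) (⟨dual,vector⟩≉0 zero) (λ ()) (λ _ _ ())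
    ; covers = (λ _ → 1#) , (λ s → sym (trans (+-identityʳ _) (*-identityˡ _)))
    ; inBasisSpan = λ { zero → coeff , λ s → refl } }
    where open RankDecomposition D
  ... | no r≰i with ℕₚ.m≤n⇒∃[o]m+o≡n (ℕₚ.<⇒≤ (ℕₚ.≰⇒> r≰i))
  ...   | o , ≡.refl = record
    { size = suc size ; size≤ = s≤s size≤ ; vectors = vector D₁ ∷ vectors
    ; rank≤ = λ { zero → suc i , ℕₚ.≤-refl , rank D₁ ; (suc t) → rank≤ t }
    ; independent = LinIndep-∷ (dual D zero) (⟨dual,vector⟩≉0 D₁ zero) orthogonal independent
    ; covers = (1# ∷ proj₁ covers) , λ s → begin
        vector D s                       ≈⟨ sum-split (suc i) o (λ t → coeff D t * basis D t s) ⟩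
        vector D₁ s + vector D₂ s        ≈⟨ +-cong (sym (*-identityˡ _)) (proj₂ covers s) ⟩
        1# * vector D₁ s + sum size (λ t → proj₁ covers t * vectors t s) ∎
    ; inBasisSpan = λ
        { zero    → InSpan-trans {h = basis D} (λ t → InSpan-generator (basis D) (t ↑ˡ o)) (coeff D₁ , λ s → refl)
        ; (suc t) → InSpan-trans {h = basis D} (λ t → InSpan-generator (basis D) (suc i ↑ʳ t)) (inBasisSpan t) } }
    where
    open RankDecomposition
    D₁ = restrictˡ {m = suc i} {p = o} D
    D₂ = restrictʳ {m = suc i} {p = o} D
    open Cover (cover i k o (ℕₚ.+-cancelˡ-≤ (suc i) o (k ℕ.* suc i) r≤ki) D₂)
    orthogonal : ∀ t → ⟨ dual D zero , vectors t ⟩ ≈ 0#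
    orthogonal t = let (γ , vt≈γb) = inBasisSpan t in begin
      ⟨ dual D zero , vectors t ⟩                                 ≈⟨ sum-cong n (λ s → *-congˡ (vt≈γb s)) ⟩
      ⟨ dual D zero , (λ s → sum o (λ t' → γ t' * basis D₂ t' s)) ⟩ ≈⟨ ⟨⟩-linearʳ o (dual D zero) γ (basis D₂) ⟩
      sum o (λ t' → γ t' * ⟨ dual D zero , basis D₂ t' ⟩)
        ≈⟨ sum-zero o (λ t' → trans (*-congˡ (dual-basis D zero (suc i ↑ʳ t'))) (zeroʳ _)) ⟩
      0#                                                          ∎

module LatticeRankWeights {c ℓ : Level} (F : Field c ℓ) (K : Pred (Field.Carrier F) (c ⊔ ℓ))
  (K-subfield : IsSubfield F K) {N : ℕ} (F-finite : HasCard F (λ _ → ⊤) N) {q : ℕ} (K-finite : HasCard F K q)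
  {n : ℕ} (C : Pred (Vec F n) (c ⊔ ℓ)) (C-subspace : IsSubspace F C)
  {k : ℕ} (C-dim : HasDim F C k) {d : ℕ} (d-min : IsMinRankDist F K C d) where

  open Field F hiding (zero)
  open FieldSums F
  open Rank F K K-subfield F-finite K-finite
  open IsSubfield K-subfield using () renaming
    (resp to K-resp; zero∈ to K-0; *-cl to K-*; inv-cl to K-inv)

  Subset : Set (Level.suc (c ⊔ ℓ))
  Subset = Pred (Vec F n) (c ⊔ ℓ)

  LinIndep-single : ∀ {v : Vec F n} → ¬ IsZeroVec F v → LinIndep F (λ (_ : Fin 1) → v)
  LinIndep-single {v} v≉0 a av≈0 zero with ¬∀⟶∃¬ n (λ s → v s ≈ 0#) (λ s → v s ≟ 0#) v≉0
  ... | s , vs≉0 = x*y≈0⇒x≈0 (trans (sym (+-identityʳ _)) (av≈0 s)) vs≉0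

  InLattice-span : ∀ {i w} (z : Fin w → Vec F n) → (∀ t → RankAtMost i (z t)) → InLattice F K i (InSpan F z)
  InLattice-span {w = w} z z-rank = w , z , z-rank , λ x → id , id

  HasDim-span : ∀ {w} (z : Fin w → Vec F n) → LinIndep F z → HasDim F (InSpan F z) w
  HasDim-span z z-indep = z , InSpan-generator z , z-indep , λ x → id

  record LatticeBasis (i : ℕ) (X : Subset) (w : ℕ) : Set (c ⊔ ℓ) where
    field
      size        : ℕ
      size≤       : size ≤ w
      vectors     : Fin size → Vec F n
      rank≤       : ∀ t → RankAtMost i (vectors t)
      independent : LinIndep F vectors
      spanning    : ∀ x → X x → InSpan F vectors x

  latticeBasis : ∀ {i w} {X : Subset} → InLattice F K i X → HasDim F X w → LatticeBasis i X w
  latticeBasis {i} {w} {X} (M , g , g-rank , X⇔span) (b , b∈X , b-indep , b-spans) = record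
    { size = size
    ; size≤ = FL.Independent⇒≤ w size b basis (λ t → InSpan⇒Span (b-spans (basis t) (basis∈X t)))
                independent
    ; vectors = basis
    ; rank≤ = λ t → let (u , eq) = generator t in ≡.subst (RankAtMost i) (≡.sym eq) (g-rank u)
    ; independent = Independent⇒LinIndep independent
    ; spanning = λ x x∈X → InSpan-trans (Span⇒InSpan ∘ spanning) (proj₁ (X⇔span x) x∈X) }
    where
    open FL.SubBasis (FL.subBasis FL-Span? M g)
    basis∈X : ∀ t → X (basis t)
    basis∈X t = let (u , eq) = generator t in
      proj₂ (X⇔span (basis t)) (≡.subst (InSpan F g) (≡.sym eq) (InSpan-generator g u))

  InLattice-mono : ∀ {i i'} {X : Subset} → i ≤ i' → InLattice F K i X → InLattice F K i' X
  InLattice-mono i≤i' (M , g , g-rank , X⇔span) =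
    M , g , (λ t → let (r , r≤i , hr) = g-rank t in r , ℕₚ.≤-trans r≤i i≤i' , hr) , X⇔span

  d≤w*i : ∀ {i w} {X : Subset} → InLattice F K i X → HasDim F X w → DimAtLeast F (_∩_ F C X) 1 → d ≤ w ℕ.* i
  d≤w*i {i} {w} X-lattice X-dim (y , y∈C∩X , y-indep) = ℕₚ.≤-trans
    (proj₂ d-min (y zero) r (proj₁ (y∈C∩X zero)) y≉0 y-rank)
    (ℕₚ.≤-trans (rank-InSpan≤ vectors i rank≤ (spanning _ (proj₂ (y∈C∩X zero))) r y-rank) (ℕₚ.*-monoˡ-≤ i size≤))
    where
    open LatticeBasis (latticeBasis X-lattice X-dim)
    y≉0 : ¬ IsZeroVec F (y zero)
    y≉0 = FL.Independent⇒nonzero y (LinIndep⇒Independent {g = y} y-indep) zero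
    r : ℕ
    r = proj₁ (∃-rank (y zero))
    y-rank : HasRank F K (y zero) r
    y-rank = proj₂ (∃-rank (y zero))

  -- The span of the blocks of a codeword of rank d.
  optimalLattice : ∀ i → Σ ℕ λ w → w ≤ ceilDiv d (suc i) × Σ Subset λ X →
    InLattice F K (suc i) X × HasDim F X w × DimAtLeast F (_∩_ F C X) 1
  optimalLattice i =
    size , size≤ , InSpan F vectors , InLattice-span vectors rank≤ , HasDim-span vectors independent ,
    (λ _ → v) , (λ _ → v∈C , InSpan-resp (λ s → sym (v≈D s)) covers) , LinIndep-single v≉0
    where
    v : Vec F n
    v = proj₁ (proj₁ d-min)
    v∈C : C v
    v∈C = proj₁ (proj₂ (proj₁ d-min))
    v≉0 : ¬ IsZeroVec F v
    v≉0 = proj₁ (proj₂ (proj₂ (proj₁ d-min)))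
    D : RankDecomposition n d
    D = proj₁ (rankDecomposition v (proj₂ (proj₂ (proj₂ (proj₁ d-min)))))
    v≈D : ∀ s → v s ≈ RankDecomposition.vector D s
    v≈D = proj₂ (rankDecomposition v (proj₂ (proj₂ (proj₂ (proj₁ d-min)))))
    open Cover (cover i (ceilDiv d (suc i)) d (d≤⌈d/i⌉*i d i) D)

  unit : Fin n → Vec F n
  unit s s' = δ s s'

  unit-expand : ∀ (x : Vec F n) s → x s ≈ sum n (λ t → x t * unit t s)
  unit-expand x s = sym (trans (sum-cong n (λ t → trans (*-comm _ _) (*-congʳ (reflexive (δ-sym t s))))) (sum-δ n s x))

  unit-rank : ∀ s → HasRank F K (unit s) 1
  unit-rank s = (λ _ → 1#) , (λ a Ka a1≈0 → λ { zero → trans (sym (*-identityʳ _)) (trans (sym (+-identityʳ _)) a1≈0) }) ,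
    (λ _ → δ s , KL.S-δ s , sym (trans (sum-δ n s (unit s)) (δ-diag s))) ,
    (λ s' → (λ _ → δ s s') , (λ _ → KL.S-δ s s') , sym (trans (+-identityʳ _) (*-identityʳ _)))

  whole : Subset
  whole _ = ⊤

  whole-lattice : ∀ i → 1 ≤ i → InLattice F K i whole
  whole-lattice i 1≤i = n , unit , (λ s → 1 , 1≤i , unit-rank s) , λ x → (λ _ → (λ t → x t) , unit-expand x) , λ _ → tt

  whole-dim : HasDim F whole n
  whole-dim = unit , (λ _ → tt) , (λ a au≈0 s → trans (unit-expand a s) (au≈0 s)) , λ x _ → (λ t → x t) , unit-expand x

  open Σ C-dim renaming (proj₁ to C-basis)
  open Σ (proj₂ C-dim) renaming (proj₁ to C-basis∈C)
  open Σ (proj₂ (proj₂ C-dim)) renaming (proj₁ to C-basis-indep; proj₂ to C-basis-spans)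

  k≤n : k ≤ n
  k≤n = FL.Independent⇒≤ n k unit C-basis (λ t → InSpan⇒Span ((λ s → C-basis t s) , unit-expand (C-basis t)))
          (LinIndep⇒Independent C-basis-indep)

  DimAtLeast-≤ : ∀ {j j'} {X : Subset} → j ≤ j' → DimAtLeast F X j' → DimAtLeast F X j
  DimAtLeast-≤ {j} {j'} {X} j≤j' X-dim with ℕₚ.m≤n⇒m<n∨m≡n j≤j'
  ... | inj₂ ≡.refl = X-dim
  ... | inj₁ (s≤s j≤j'-1) = let (y , y∈X , y-indep) = X-dim in
    DimAtLeast-≤ {X = X} j≤j'-1
      (y ∘ suc , y∈X ∘ suc , Independent⇒LinIndep (FL.Independent-tail y (LinIndep⇒Independent {g = y} y-indep)))

  C∩whole : ∀ j → j ≤ k → DimAtLeast F (_∩_ F C whole) j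
  C∩whole j j≤k = DimAtLeast-≤ {X = _∩_ F C whole} j≤k (C-basis , (λ t → C-basis∈C t , tt) , C-basis-indep)

  IsWeight : ℕ → ℕ → ℕ → Set (Level.suc (c ⊔ ℓ))
  IsWeight i j w = IsLatticeRankWeight F K i j C w

  RespectsPointwise : ∀ {w} → Pred (Fin w → Vec F n) (c ⊔ ℓ) → Set (c ⊔ ℓ)
  RespectsPointwise {w} Q = ∀ f g → (∀ t s → f t s ≈ g t s) → Q f → Q g

  ∃-family? : ∀ w (Q : Pred (Fin w → Vec F n) (c ⊔ ℓ)) → RespectsPointwise Q → U.Decidable Q →
    Dec (Σ (Fin w → Vec F n) Q)
  ∃-family? zero Q Q-resp Q? with Q? (λ ())
  ... | yes q = yes (_ , q)
  ... | no ¬q = no λ (f , q) → ¬q (Q-resp f _ (λ ()) q)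
  ∃-family? (suc w) Q Q-resp Q? with ∃? n (λ v → Σ (Fin w → Vec F n) λ g → Q (v ∷ g))
       (λ v v' v≈v' (g , q) → g , Q-resp _ _ (λ { zero s → v≈v' s ; (suc t) s → refl }) q)
       (λ v → ∃-family? w (λ g → Q (v ∷ g)) (λ f g f≈g → Q-resp _ _ λ { zero s → refl ; (suc t) s → f≈g t s })
                     (λ g → Q? (v ∷ g)))
  ... | yes (v , g , q) = yes (_ , q)
  ... | no none = no λ (f , q) → none (f zero , f ∘ suc , Q-resp f _ (λ { zero s → refl ; (suc t) s → refl }) q)

  InKSpan? : ∀ {r} (b : Fin r → Carrier) x → Dec (InKSpan F K b x)
  InKSpan? {r} b x = ∃? r _
    (λ a a' a≈a' (Ka , x≈ab) → (λ t → K-resp (a≈a' t) (Ka t)) , trans x≈ab (sum-cong r (λ t → *-congʳ (a≈a' t))))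
    (λ a → all? (λ t → K? (a t)) ×-dec (x ≟ sum r (λ t → a t * b t)))

  KIndep? : ∀ {r} (b : Fin r → Carrier) → Dec (KIndep F K b)
  KIndep? {r} b = ∀? r _
    (λ a a' a≈a' indep Ka' a'b≈0 t → trans (sym (a≈a' t)) (indep (λ t → K-resp (sym (a≈a' t)) (Ka' t))
        (trans (sum-cong r (λ t → *-congʳ (a≈a' t))) a'b≈0) t))
    (λ a → all? (λ t → K? (a t)) →-dec ((sum r (λ t → a t * b t) ≟ 0#) →-dec all? (λ t → a t ≟ 0#)))

  HasRank-resp : ∀ {v v' : Vec F n} {r} → (∀ s → v s ≈ v' s) → HasRank F K v r → HasRank F K v' r
  HasRank-resp v≈v' (b , b-indep , b⊆v , v⊆b) = b , b-indep ,
    (λ t → let (a , Ka , bt≈av) = b⊆v t in a , Ka , trans bt≈av (sum-cong n (λ s → *-congˡ (v≈v' s)))) ,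
    (λ s → let (a , Ka , vs≈ab) = v⊆b s in a , Ka , trans (sym (v≈v' s)) vs≈ab)

  HasRank? : ∀ (v : Vec F n) r → Dec (HasRank F K v r)
  HasRank? v r = ∃? r _
    (λ b b' b≈b' (b-indep , b⊆v , v⊆b) →
       (λ a Ka ab'≈0 → b-indep a Ka (trans (sum-cong r (λ t → *-congˡ (b≈b' t))) ab'≈0)) ,
       (λ t → let (a , Ka , bt≈av) = b⊆v t in a , Ka , trans (sym (b≈b' t)) bt≈av) ,
       (λ s → let (a , Ka , vs≈ab) = v⊆b s in a , Ka , trans vs≈ab (sum-cong r (λ t → *-congˡ (b≈b' t)))))
    (λ b → KIndep? b ×-dec all? (λ t → InKSpan? v (b t)) ×-dec all? (λ s → InKSpan? b (v s)))

  RankAtMost? : ∀ i (v : Vec F n) → Dec (RankAtMost i v)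
  RankAtMost? i v = LeastWitness.∃≤? (HasRank? v) i

  InSpan? : ∀ {r} (g : Fin r → Vec F n) x → Dec (InSpan F g x)
  InSpan? {r} g x = ∃? r _
    (λ a a' a≈a' x≈ag s → trans (x≈ag s) (sum-cong r (λ t → *-congʳ (a≈a' t))))
    (λ a → all? (λ s → x s ≟ sum r (λ t → a t * g t s)))

  LinIndep? : ∀ {r} (y : Fin r → Vec F n) → Dec (LinIndep F y)
  LinIndep? {r} y = ∀? r _
    (λ a a' a≈a' indep a'y≈0 t → trans (sym (a≈a' t)) (indep (λ s → trans (sum-cong r (λ t → *-congʳ (a≈a' t))) (a'y≈0 s)) t))
    (λ a → all? (λ s → sum r (λ t → a t * y t s) ≟ 0#) →-dec all? (λ t → a t ≟ 0#))

  -- Decidable form of the existence of an admissible lattice space: membership in C is tested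
  -- through the basis of C, and the space is given by generators rather than as a predicate.
  Witness : ℕ → ℕ → ℕ → Set (c ⊔ ℓ)
  Witness i j w = Σ (Fin w → Vec F n) λ g → (∀ t → RankAtMost i (g t)) × Σ (Fin j → Vec F n) λ y →
    (∀ t → InSpan F C-basis (y t) × InSpan F g (y t)) × LinIndep F y

  Witness? : ∀ i j → U.Decidable (Witness i j)
  Witness? i j w = ∃-family? w _
    (λ g g' g≈g' (g-rank , y , y∈ , y-indep) →
       (λ t → let (r , r≤i , hr) = g-rank t in r , r≤i , HasRank-resp (g≈g' t) hr) ,
       y , (λ t → proj₁ (y∈ t) ,
              (let (a , yt≈ag) = proj₂ (y∈ t) in a , λ s → trans (yt≈ag s) (sum-cong w (λ t' → *-congˡ (g≈g' t' s))))) ,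
       y-indep)
    (λ g → all? (λ t → RankAtMost? i (g t)) ×-dec
           ∃-family? j _
             (λ y y' y≈y' (y∈ , y-indep) →
                (λ t → InSpan-resp (y≈y' t) (proj₁ (y∈ t)) , InSpan-resp (y≈y' t) (proj₂ (y∈ t))) ,
                (λ a ay'≈0 → y-indep a (λ s → trans (sum-cong j (λ t → *-congˡ (y≈y' t s))) (ay'≈0 s))))
             (λ y → all? (λ t → InSpan? C-basis (y t) ×-dec InSpan? g (y t)) ×-dec LinIndep? y))

  Admissible : ℕ → ℕ → ℕ → Set (Level.suc (c ⊔ ℓ))
  Admissible i j w = Σ Subset λ X → InLattice F K i X × HasDim F X w × DimAtLeast F (_∩_ F C X) j

  Admissible⇒Witness : ∀ {i j w} → Admissible i j w → Σ ℕ λ w' → w' ≤ w × Witness i j w'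
  Admissible⇒Witness (X , X-lattice , X-dim , (y , y∈C∩X , y-indep)) =
    size , size≤ , vectors , rank≤ ,
    y , (λ t → C-basis-spans _ (proj₁ (y∈C∩X t)) , spanning _ (proj₂ (y∈C∩X t))) , y-indep
    where open LatticeBasis (latticeBasis X-lattice X-dim)

  Witness⇒Admissible : ∀ {i j w} → Witness i j w → Σ ℕ λ w' → w' ≤ w × Admissible i j w'
  Witness⇒Admissible {w = w} (g , g-rank , y , y∈ , y-indep) =
    size , size≤ , InSpan F g , InLattice-span g g-rank ,
    (basis , (λ t → let (u , eq) = generator t in ≡.subst (InSpan F g) (≡.sym eq) (InSpan-generator g u)) ,
             Independent⇒LinIndep independent , (λ x x∈g → InSpan-trans (Span⇒InSpan ∘ spanning) x∈g)) ,
    y , (λ t → InSpan⊆ C-subspace C-basis∈C (proj₁ (y∈ t)) , proj₂ (y∈ t)) , y-indep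
    where open FL.SubBasis (FL.subBasis FL-Span? w g)

  weight-exists : ∀ {i j} → 1 ≤ i → j ≤ k → Σ ℕ (IsWeight i j)
  weight-exists {i} {j} 1≤i j≤k =
    let (w₀ , witness , w₀-least) = least n (Admissible⇒Witness (whole , whole-lattice i 1≤i , whole-dim , C∩whole j j≤k))
        (w , w≤w₀ , admissible) = Witness⇒Admissible witness in
    w , admissible , λ X w' X-lattice X-dim C∩X →
      let (w'' , w''≤w' , witness') = Admissible⇒Witness (X , X-lattice , X-dim , C∩X) in
      ℕₚ.≤-trans w≤w₀ (ℕₚ.≤-trans (w₀-least w'' witness') w''≤w')
    where open LeastWitness (Witness? i j)

  weight≤n : ∀ {i j w} → 1 ≤ i → j ≤ k → IsWeight i j w → w ≤ n
  weight≤n 1≤i j≤k (_ , minimal) = minimal whole n (whole-lattice _ 1≤i) whole-dim (C∩whole _ j≤k)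

  weight-antitone : ∀ {i i' j w w'} → i ≤ i' → IsWeight i' j w → IsWeight i j w' → w ≤ w'
  weight-antitone i≤i' (_ , minimal) ((X , X-lattice , X-dim , C∩X) , _) =
    minimal X _ (InLattice-mono i≤i' X-lattice) X-dim C∩X

  weight₁≡⌈d/i⌉ : ∀ {i w} → 1 ≤ i → IsWeight i 1 w → w ≡ ceilDiv d i
  weight₁≡⌈d/i⌉ {suc i} {w} _ ((X , X-lattice , X-dim , C∩X) , minimal) = ℕₚ.≤-antisym
    (let (w₁ , w₁≤⌈d/i⌉ , X₁ , X₁-lattice , X₁-dim , C∩X₁) = optimalLattice i in
     ℕₚ.≤-trans (minimal X₁ w₁ X₁-lattice X₁-dim C∩X₁) w₁≤⌈d/i⌉)
    (⌈d/i⌉≤w d i w (d≤w*i X-lattice X-dim C∩X))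

  -- Eliminating one generator of an optimal space for j+1 keeps j independent codewords.
  weight<weight-suc : ∀ {i j w w'} → IsWeight i j w → IsWeight i (suc j) w' → w < w'
  weight<weight-suc {i} {j} {w} {w'} (_ , minimal) ((X , X-lattice , X-dim , (y , y∈C∩X , y-indep)) , _) =
    below (latticeBasis X-lattice X-dim)
    where
    y⊆ : ∀ {s} (e : Fin s → Vec F n) → (∀ x → X x → InSpan F e x) → ∀ t → FL.Span e (y t)
    y⊆ e e-spans t = InSpan⇒Span (e-spans (y t) (proj₂ (y∈C∩X t)))
    below : LatticeBasis i X w' → w < w'
    below record { size = zero ; vectors = e ; spanning = e-spans } =
      contradiction (FL.Independent⇒≤ 0 (suc j) e y (y⊆ e e-spans) (LinIndep⇒Independent {g = y} y-indep)) λ ()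
    below record { size = suc s ; size≤ = s<w' ; vectors = e ; rank≤ = e-rank ; independent = e-indep
                 ; spanning = e-spans } =
      ℕₚ.<-≤-trans (s≤s (minimal (InSpan F (e ∘ suc)) s (InLattice-span (e ∘ suc) (e-rank ∘ suc))
        (HasDim-span (e ∘ suc) (Independent⇒LinIndep (FL.Independent-tail e (LinIndep⇒Independent {g = e} e-indep))))
        (y' , (λ t → y'∈C t , Span⇒InSpan (y'∈span t)) ,
         Independent⇒LinIndep (FL.Independent-eliminate y s₀ μ (λ _ → tt) (LinIndep⇒Independent {g = y} y-indep)))))
        s<w'
      where
      eliminated = FL.eliminate e y (y⊆ e e-spans)
      s₀ : Fin (suc j)
      s₀ = proj₁ eliminated
      μ : Fin j → Carrier
      μ = proj₁ (proj₂ eliminated)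
      y' : Fin j → Vec F n
      y' t u = y (punchIn s₀ t) u + μ t * y s₀ u
      y'∈span : ∀ t → FL.Span (e ∘ suc) (y' t)
      y'∈span = proj₂ (proj₂ (proj₂ eliminated))
      y'∈C : ∀ t → C (y' t)
      y'∈C t = IsSubspace.+-cl C-subspace (proj₁ (y∈C∩X _)) (IsSubspace.*-cl C-subspace (μ t) (proj₁ (y∈C∩X s₀)))

  ⌈d/i⌉+j≤weight : ∀ {i} → 1 ≤ i → ∀ j → suc j ≤ k → ∀ {w} → IsWeight i (suc j) w → ceilDiv d i ℕ.+ j ≤ w
  ⌈d/i⌉+j≤weight 1≤i zero    _     w-weight =
    ℕₚ.≤-reflexive (≡.trans (ℕₚ.+-identityʳ _) (≡.sym (weight₁≡⌈d/i⌉ 1≤i w-weight)))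
  ⌈d/i⌉+j≤weight {i} 1≤i (suc j) 2+j≤k {w} w-weight =
    let (w₀ , w₀-weight) = weight-exists 1≤i 1+j≤k in begin
      ceilDiv d i ℕ.+ suc j   ≡⟨ ℕₚ.+-suc _ j ⟩
      suc (ceilDiv d i ℕ.+ j) ≤⟨ s≤s (⌈d/i⌉+j≤weight 1≤i j 1+j≤k w₀-weight) ⟩
      suc w₀                  ≤⟨ weight<weight-suc w₀-weight w-weight ⟩
      w                       ∎
    where
    open ℕₚ.≤-Reasoning
    1+j≤k : suc j ≤ k
    1+j≤k = ℕₚ.<⇒≤ 2+j≤k

  ⌈d/i⌉+j∸1≤weight : ∀ {i j w} → 1 ≤ i → 1 ≤ j → j ≤ k → IsWeight i j w → ceilDiv d i ℕ.+ j ∸ 1 ≤ w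
  ⌈d/i⌉+j∸1≤weight {i} {suc j} {w} 1≤i _ j≤k w-weight =
    ≡.subst (_≤ w) (≡.sym (≡.cong (_∸ 1) (ℕₚ.+-suc (ceilDiv d i) j))) (⌈d/i⌉+j≤weight 1≤i j j≤k w-weight)

  weight≤n∸k+j : ∀ {i} → 1 ≤ i → ∀ gap {j} → gap ℕ.+ j ≡ k → ∀ {w} → IsWeight i j w → w ≤ n ∸ k ℕ.+ j
  weight≤n∸k+j 1≤i zero ≡.refl w-weight =
    ≡.subst (_ ≤_) (≡.sym (ℕₚ.m∸n+n≡m k≤n)) (weight≤n 1≤i ℕₚ.≤-refl w-weight)
  weight≤n∸k+j 1≤i (suc gap) {j} gap+j≡k {w} w-weight =
    let (w' , w'-weight) = weight-exists 1≤i 1+j≤k in ℕ.s≤s⁻¹ (begin-strict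
      w                         <⟨ weight<weight-suc w-weight w'-weight ⟩
      w'                        ≤⟨ weight≤n∸k+j 1≤i gap (≡.trans (ℕₚ.+-suc gap j) gap+j≡k) w'-weight ⟩
      n ∸ k ℕ.+ suc j           ≡⟨ ℕₚ.+-suc _ j ⟩
      suc (n ∸ k ℕ.+ j)         ∎)
    where
    open ℕₚ.≤-Reasoning
    1+j≤k : suc j ≤ k
    1+j≤k = ≡.subst (suc j ≤_) gap+j≡k (s≤s (ℕₚ.m≤n+m j gap))

  InSpan-multiple : ∀ {r} (y : Fin r → Vec F n) t λ' (x : Vec F n) → (∀ s → x s ≈ λ' * y t s) → InSpan F y x
  InSpan-multiple {r} y t λ' x x≈λy = (λ t' → δ t t' * λ') , λ s → begin
    x s                                ≈⟨ x≈λy s ⟩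
    λ' * y t s                         ≈⟨ sym (sum-δ r t (λ t' → λ' * y t' s)) ⟩
    sum r (λ t' → δ t t' * (λ' * y t' s))   ≈⟨ sum-cong r (λ t' → sym (*-assoc _ _ _)) ⟩
    sum r (λ t' → (δ t t' * λ') * y t' s)   ∎
    where open import Relation.Binary.Reasoning.Setoid setoid

  rank≤1⇒rationalMultiple : ∀ (g : Vec F n) → RankAtMost 1 g → Σ (Vec F n) λ u → (∀ s → K (u s)) ×
    Σ Carrier λ λ₀ → Σ Carrier λ λ₁ → (∀ s → g s ≈ λ₀ * u s) × (∀ s → u s ≈ λ₁ * g s)
  rank≤1⇒rationalMultiple g (zero , _ , _ , _ , _ , g⊆b) = (λ _ → 0#) , (λ _ → K-0) , 0# , 0# ,
    (λ s → trans (proj₂ (proj₂ (g⊆b s))) (sym (zeroˡ _))) , (λ s → sym (zeroˡ _))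
  rank≤1⇒rationalMultiple g (suc zero , _ , b , b-indep , _ , g⊆b) = u , (λ s → proj₁ (proj₂ (g⊆b s)) zero) ,
    b zero , b⁻¹ , g≈bu , λ s → sym (u≈b⁻¹g s)
    where
    b≉0 = KIndep⇒nonzero b b-indep zero
    b⁻¹ = proj₁ (inverse (b zero) b≉0)
    u : Vec F n
    u s = proj₁ (g⊆b s) zero
    g≈bu : ∀ s → g s ≈ b zero * u s
    g≈bu s = trans (proj₂ (proj₂ (g⊆b s))) (trans (+-identityʳ _) (*-comm _ _))
    u≈b⁻¹g : ∀ s → b⁻¹ * g s ≈ u s
    u≈b⁻¹g s = trans (*-congˡ (g≈bu s)) (trans (sym (*-assoc _ _ _))
      (trans (*-congʳ (trans (*-comm _ _) (proj₂ (inverse (b zero) b≉0)))) (*-identityˡ _)))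
  rank≤1⇒rationalMultiple g (suc (suc _) , s≤s () , _)

  rational⇒rank≤1 : (z : Vec F n) → (∀ s → K (z s)) → RankAtMost 1 z
  rational⇒rank≤1 z Kz with all? (λ s → z s ≟ 0#)
  ... | yes z≈0 = 0 , z≤n , (λ ()) , (λ _ _ _ ()) , (λ ()) , λ s → (λ ()) , (λ ()) , z≈0 s
  ... | no  z≉0 with ¬∀⟶∃¬ n (λ s → z s ≈ 0#) (λ s → z s ≟ 0#) z≉0
  ...   | s , zs≉0 = 1 , ℕₚ.≤-refl , (λ _ → 1#) ,
          (λ a _ a1≈0 → λ { zero → trans (sym (*-identityʳ _)) (trans (sym (+-identityʳ _)) a1≈0) }) ,
          (λ _ → (λ s' → δ s s' * zs⁻¹) , (λ s' → K-* (KL.S-δ s s') (K-inv (Kz s) zszs⁻¹≈1)) ,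
                 sym (trans (sum-cong n (λ s' → *-assoc _ _ _)) (trans (sum-δ n s (λ s' → zs⁻¹ * z s'))
                   (trans (*-comm _ _) zszs⁻¹≈1)))) ,
          λ s' → (λ _ → z s') , (λ _ → Kz s') , sym (trans (+-identityʳ _) (*-identityʳ _))
    where
    zs⁻¹ = proj₁ (inverse (z s) zs≉0)
    zszs⁻¹≈1 : z s * zs⁻¹ ≈ 1#
    zszs⁻¹≈1 = proj₂ (inverse (z s) zs≉0)

  InLattice⇒IsSubspace : ∀ {i} {X : Subset} → InLattice F K i X → IsSubspace F X
  InLattice⇒IsSubspace {X = X} (_ , g , _ , X⇔span) = record
    { resp  = λ u≈v Xu → to (IsSubspace.resp span u≈v (from Xu))
    ; zero∈ = to (IsSubspace.zero∈ span)
    ; +-cl  = λ Xu Xv → to (IsSubspace.+-cl span (from Xu) (from Xv))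
    ; *-cl  = λ a Xu → to (IsSubspace.*-cl span a (from Xu)) }
    where
    span = InSpan-isSubspace g
    to : ∀ {x} → InSpan F g x → X x
    to = proj₂ (X⇔span _)
    from : ∀ {x} → X x → InSpan F g x
    from = proj₁ (X⇔span _)

  DimAtLeast-∩-comm : ∀ {j} {A B : Subset} → DimAtLeast F (_∩_ F A B) j → DimAtLeast F (_∩_ F B A) j
  DimAtLeast-∩-comm (y , y∈A∩B , y-indep) = y , (λ t → proj₂ (y∈A∩B t) , proj₁ (y∈A∩B t)) , y-indep

  -- A rank-one generator is a multiple of a K-rational vector and conversely, so the lattice
  -- spaces of 𝓛_1 are exactly the K-rational spaces.
  weight¹⇒genRankWeight : ∀ {j w} → IsWeight 1 j w → IsGenRankWeight F K j C w
  weight¹⇒genRankWeight {j} {w} ((X , (M , g , g-rank , X⇔span) , X-dim , C∩X) , minimal) =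
    (X , (InLattice⇒IsSubspace {X = X} (M , g , g-rank , X⇔span) , size , basis , basis-rational , basis∈X ,
          Independent⇒LinIndep independent , X⊆basis) ,
     X-dim , DimAtLeast-∩-comm {A = C} {B = X} C∩X) ,
    λ A w' (A-sub , _ , b , b-rational , b∈A , _ , A⊆b) A-dim A∩C →
      minimal A w' (_ , b , (λ t → rational⇒rank≤1 (b t) (b-rational t)) , λ x → A⊆b x , InSpan⊆ A-sub b∈A)
        A-dim (DimAtLeast-∩-comm {A = A} {B = C} A∩C)
    where
    multiple = λ t → rank≤1⇒rationalMultiple (g t) (g-rank t)
    u : Fin M → Vec F n
    u t = proj₁ (multiple t)
    open FL.SubBasis (FL.subBasis FL-Span? M u)
    basis-rational : ∀ t s → K (basis t s)
    basis-rational t s = let (v , eq) = generator t in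
      ≡.subst (λ z → K (z s)) (≡.sym eq) (proj₁ (proj₂ (multiple v)) s)
    basis∈X : ∀ t → X (basis t)
    basis∈X t = let (v , eq) = generator t ; (_ , _ , _ , λ₁ , _ , u≈λ₁g) = multiple v in
      ≡.subst X (≡.sym eq) (proj₂ (X⇔span (u v)) (InSpan-multiple g v λ₁ (u v) u≈λ₁g))
    X⊆basis : ∀ x → X x → InSpan F basis x
    X⊆basis x x∈X = InSpan-trans (Span⇒InSpan ∘ spanning) (InSpan-trans
      (λ v → let (_ , _ , λ₀ , _ , g≈λ₀u , _) = multiple v in InSpan-multiple u v λ₀ (g v) g≈λ₀u)
      (proj₁ (X⇔span x) x∈X))

open import Data.Nat using (_+_)

theorem6p6 : ∀ {c ℓ : Level} (F : Field c ℓ) (K : Pred (Field.Carrier F) (c ⊔ ℓ))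
  (q m n : ℕ) → IsPrimePower q → 2 ≤ m → 2 ≤ n
  → IsSubfield F K → HasCard F (λ _ → ⊤) (q ^ m) → HasCard F K q
  → (C : Pred (Vec F n) (c ⊔ ℓ)) → IsSubspace F C
  → (k : ℕ) → 1 ≤ k → HasDim F C k
  → (d : ℕ) → IsMinRankDist F K C d
  → -- (0) the lattice-rank weights exist
    (∀ i j → 1 ≤ i → i ≤ n → 1 ≤ j → j ≤ k →
       Σ ℕ λ w → IsLatticeRankWeight F K i j C w)
    -- (1)
  × (∀ j → 1 ≤ j → j ≤ k → ∀ w →
       IsLatticeRankWeight F K 1 j C w → IsGenRankWeight F K j C w)
    -- (2)
  × (∀ i → 1 ≤ i → i ≤ n → ∀ w →
       IsLatticeRankWeight F K i 1 C w → w ≡ ceilDiv d i)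
    -- (3)
  × (∀ i j → 1 ≤ i → i ≤ n → 1 ≤ j → j ≤ k → ∀ w →
       IsLatticeRankWeight F K i j C w → w ≤ n)
    -- (4)
  × (∀ i j → 1 ≤ i → i ≤ n → 1 ≤ j → j ≤ k ∸ 1 → ∀ w w' →
       IsLatticeRankWeight F K i j C w →
       IsLatticeRankWeight F K i (suc j) C w' → w < w')
    -- (5)
  × (∀ i j → 1 ≤ i → i ≤ n ∸ 1 → 1 ≤ j → j ≤ k → ∀ w w' →
       IsLatticeRankWeight F K (suc i) j C w →
       IsLatticeRankWeight F K i j C w' → w ≤ w')
    -- (6)
  × (∀ i j → 1 ≤ i → i ≤ n → 1 ≤ j → j ≤ k → ∀ w →
       IsLatticeRankWeight F K i j C w → w ≤ n ∸ k + j)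
    -- (7)
  × (∀ i j → 1 ≤ i → i ≤ n → 1 ≤ j → j ≤ k → ∀ w →
       IsLatticeRankWeight F K i j C w → ceilDiv d i + j ∸ 1 ≤ w)
theorem6p6 F K q m n _ _ _ K-subfield F-finite K-finite C C-subspace k _ C-dim d d-min =
    (λ i j 1≤i _ _ j≤k → weight-exists 1≤i j≤k)
  , (λ j _ _ w → weight¹⇒genRankWeight)
  , (λ i 1≤i _ w → weight₁≡⌈d/i⌉ 1≤i)
  , (λ i j 1≤i _ _ j≤k w → weight≤n 1≤i j≤k)
  , (λ i j _ _ _ _ w w' → weight<weight-suc)
  , (λ i j _ _ _ _ w w' → weight-antitone (ℕₚ.n≤1+n i))
  , (λ i j 1≤i _ _ j≤k w → weight≤n∸k+j 1≤i (k ∸ j) (ℕₚ.m∸n+n≡m j≤k))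
  , (λ i j 1≤i _ 1≤j j≤k w → ⌈d/i⌉+j∸1≤weight 1≤i 1≤j j≤k)
  where open LatticeRankWeights F K K-subfield F-finite K-finite C C-subspace C-dim d-min
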